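{- For $|q|<1$ and every integer $m\ge 0$, $$\sum_{n=0}^{\infty}\frac{q^{n^2+mn}}{(-q;q)_{m+n-1}(q;q)_n}=\frac{(-1)^{m-1}}{q^{m(m-1)/2}}\Big[(a_m(q)-b_m(q))(-q^2;q^2)_{\infty}-b_m(q)(-q;q^2)_{\infty}\Big],$$ where $a_0(q)=0$, $b_0(q)=1$, and for $m\ge1$ $$a_m(q)=\sum_{n,l\ge0}q^{n(n-1)/2+l(l+1)/2}\begin{bmatrix} m-1-l\\ n\end{bmatrix}\begin{bmatrix} n\\ l\end{bmatrix},\qquad b_m(q)=\sum_{n,l\ge0}q^{n(n+1)/2+l(l+1)/2}\begin{bmatrix} m-2-l\\ n\end{bmatrix}\begin{bmatrix} n\\ l\end{bmatrix}.$$
   Context: $(a;q)_\infty=\prod_{k\ge0}(1-aq^k)$ and, for every integer $n$ (including negative $n$), $(a;q)_n=(a;q)_\infty/(aq^n;q)_\infty$; thus $(a;q)_n=\prod_{k=0}^{n-1}(1-aq^k)$ for $n\ge0$ and $(a;q)_{ -1}=1/(1-a/q)$. The Gaussian polynomial $\begin{bmatrix} N\\ M\end{bmatrix}$ equals $\frac{(q;q)_N}{(q;q)_M(q;q)_{N-M}}$ if $0\le M\le N$ and $0$ otherwise. -}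

module Defs where

-- All series in the statement are convergent power
-- series for |q| < 1, so the analytic identity is equivalent to the identity
-- of formal power series (coefficientwise).

open import Data.Nat as ℕ using (ℕ; zero; suc; _≡ᵇ_; _≤ᵇ_; _∸_; _%_; _/_)
open import Data.Integer as ℤ using (ℤ; +_; -[1+_])
open import Data.Bool using (if_then_else_)
open import Relation.Binary.PropositionalEquality using (_≡_)

PS : Set
PS = ℕ → ℤ

_≋_ : PS → PS → Set
f ≋ g = ∀ k → f k ≡ g k
infix 4 _≋_

Σ< : ℕ → (ℕ → ℤ) → ℤ
Σ< zero    f = + 0
Σ< (suc n) f = Σ< n f ℤ.+ f n

zeroPS : PS
zeroPS _ = + 0

const : ℤ → PS
const c zero    = c
const c (suc _) = + 0

one : PS
one = const (+ 1)

mono : ℕ → PS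
mono e k = if k ≡ᵇ e then + 1 else + 0

_⊕_ : PS → PS → PS
(f ⊕ g) k = f k ℤ.+ g k

_⊖_ : PS → PS → PS
(f ⊖ g) k = f k ℤ.- g k

scale : ℤ → PS → PS
scale c f k = c ℤ.* f k

_⊛_ : PS → PS → PS
(f ⊛ g) k = Σ< (suc k) (λ i → f i ℤ.* g (k ∸ i))

infixl 7 _⊛_
infixl 6 _⊕_ _⊖_

sumPS : ℕ → (ℕ → PS) → PS
sumPS n f k = Σ< n (λ i → f i k)

prodPS : ℕ → (ℕ → PS) → PS
prodPS zero    f = one
prodPS (suc n) f = prodPS n f ⊛ f n

-- 1 - q^(j+1)  and its inverse  1/(1 - q^(j+1)) = Σ_t q^((j+1)t)
oneMinusQ : ℕ → PS
oneMinusQ j = one ⊖ mono (suc j)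

invOneMinusQ : ℕ → PS
invOneMinusQ j k = if (k % suc j) ≡ᵇ 0 then + 1 else + 0

onePlusQ : ℕ → PS
onePlusQ e = one ⊕ mono e

-- 1/(1 + q^(j+1)) = Σ_t (-1)^t q^((j+1)t)
invOnePlusQ : ℕ → PS
invOnePlusQ j k =
  if (k % suc j) ≡ᵇ 0
  then (if ((k / suc j) % 2) ≡ᵇ 0 then + 1 else -[1+ 0 ])
  else + 0

qPoch : ℕ → PS
qPoch N = prodPS N oneMinusQ

invQPoch : ℕ → PS
invQPoch N = prodPS N invOneMinusQ

-- 1/(-q;q)_{k-1} for k ≥ 0.  For k = 0 this is 1/(-q;q)_{-1} = 1 - (-q)/q = 2;
-- for k = j+1 it is Π_{i<j} 1/(1 + q^(i+1)).
invNegQPochPred : ℕ → PS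
invNegQPochPred zero    = const (+ 2)
invNegQPochPred (suc j) = prodPS j invOnePlusQ

gauss : ℤ → ℤ → PS
gauss (+ N) (+ M) =
  if M ≤ᵇ N then qPoch N ⊛ invQPoch M ⊛ invQPoch (N ∸ M) else zeroPS
gauss (+ N) -[1+ _ ] = zeroPS
gauss -[1+ _ ] _ = zeroPS

-- Infinite product Π_{k ≥ 0} (1 + q^(e k)), for exponent functions with
-- e k ≥ k + 1: the coefficient of q^d only depends on the factors with
-- k ≤ d (all other factors are ≡ 1 mod q^(d+1)).
infProdOnePlus : (ℕ → ℕ) → PS
infProdOnePlus e d = prodPS (suc d) (λ k → onePlusQ (e k)) d

negQ2Q2 : PS
negQ2Q2 = infProdOnePlus (λ k → suc (suc (2 ℕ.* k)))

negQQ2 : PS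
negQQ2 = infProdOnePlus (λ k → suc (2 ℕ.* k))

tri- : ℕ → ℕ
tri- n = (n ℕ.* (n ∸ 1)) / 2

tri+ : ℕ → ℕ
tri+ n = (n ℕ.* suc n) / 2

-- a_m(q), b_m(q).  The double sums over n, l ≥ 0 have finite support
-- (the Gaussian polynomials vanish unless l ≤ n ≤ m), so summing over
-- n, l ≤ m is the full sum.
aSeries : ℕ → PS
aSeries zero = zeroPS
aSeries m@(suc _) = sumPS (suc m) λ n → sumPS (suc m) λ l →
  mono (tri- n ℕ.+ tri+ l)
    ⊛ gauss (+ m ℤ.- + 1 ℤ.- + l) (+ n)
    ⊛ gauss (+ n) (+ l)

bSeries : ℕ → PS
bSeries zero = one
bSeries m@(suc _) = sumPS (suc m) λ n → sumPS (suc m) λ l →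
  mono (tri+ n ℕ.+ tri+ l)
    ⊛ gauss (+ m ℤ.- + 2 ℤ.- + l) (+ n)
    ⊛ gauss (+ n) (+ l)

lhsTerm : ℕ → ℕ → PS
lhsTerm m n = mono (n ℕ.* n ℕ.+ m ℕ.* n) ⊛ invNegQPochPred (m ℕ.+ n) ⊛ invQPoch n

-- Σ_{n ≥ 0} lhsTerm m n: the n-th summand is divisible by q^(n²+mn), hence by
-- q^n, so only n ≤ k contributes to the coefficient of q^k.
lhs : ℕ → PS
lhs m k = Σ< (suc k) (λ n → lhsTerm m n k)

-- (-1)^(m-1) for m ≥ 0 (m = 0 gives (-1)^(-1) = -1)
signPred : ℕ → ℤ
signPred zero = -[1+ 0 ]
signPred (suc zero) = + 1
signPred (suc (suc k)) = signPred k

-- Put Φ c j = Σ_n q^(n² + c n) / ((-q;q)_{j+n-1} (q;q)_n), so that the left-hand side is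
-- F_m = Φ m m.  Writing 1/(-q;q)_{j+n-1} = (1 + q^(j+n)) / (-q;q)_{j+n}, resp.
-- 1/(q;q)_n = (1 - q^(n+1)) / (q;q)_{n+1}, gives two linear relations between neighbouring Φ's,
-- and together they yield
--   F_m = (1 + q^m) F_{m+1} + q^(m+1) F_{m+2},
-- i.e. T_m = q^(m(m-1)/2) F_m satisfies T_{m+2} = q^m T_m - (1 + q^m) T_{m+1}.  The Pascal rules
-- for Gaussian polynomials show that a_m and b_m, hence the bracket W_m on the right, satisfy
-- W_{m+2} = (1 + q^m) W_{m+1} + q^m W_m, so (-1)^(m-1) W_m obeys the recurrence of T_m.  It
-- remains to compare T_0 and T_1: the same two relations give Φ c 1 = (1 + q^(c+1)) Φ (c+2) 1,
-- and iterating, Φ c 1 = Π_k (1 + q^(2k+c+1)); hence F_0 = (-q;q²)_∞ + (-q²;q²)_∞ and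
-- F_1 = (-q²;q²)_∞.

module Submission where

open import Defs
open import Data.Nat using (ℕ; _*_; _∸_; _/_)
open import Data.Nat as ℕ using (zero; suc; _+_; _%_; _≤_; _<_; z≤n; s≤s)
import Data.Nat.Properties as ℕₚ
open import Data.Nat.DivMod using ([m+n]%n≡m%n; m<n⇒m%n≡m; m/n≡1+[m∸n]/n; m*n/n≡m)
open import Data.Nat.Tactic.RingSolver using (solve-∀)
open import Data.Integer as ℤ using (ℤ; +_; -[1+_])
import Data.Integer.Properties as ℤₚ
open import Data.Bool using (true; false; if_then_else_)
open import Data.Maybe using (Maybe; just; nothing)
open import Data.Product using (_×_; _,_; proj₁)
open import Data.Sum using (inj₁; inj₂)
open import Function using (_∘_)
open import Relation.Binary.PropositionalEquality
open import Relation.Binary.Bundles using (Setoid)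
open import Relation.Binary.Definitions using (tri<; tri≈; tri>)
open import Relation.Binary.Structures using (IsEquivalence)
import Relation.Binary.Reasoning.Setoid
open import Relation.Nullary using (yes; no)
open import Relation.Nullary.Decidable using (dec-true; dec-false)
open import Algebra.Bundles using (CommutativeRing)
open import Algebra.Properties.CommutativeSemigroup ℤₚ.+-commutativeSemigroup using (interchange)
open import Algebra.Solver.Ring.AlmostCommutativeRing using (fromCommutativeRing; _-Raw-AlmostCommutative⟶_)
import Algebra.Solver.Ring as RingSolver

-- Finite sums

Σ<-cong : ∀ n {f g : ℕ → ℤ} → (∀ i → i < n → f i ≡ g i) → Σ< n f ≡ Σ< n g
Σ<-cong zero    f≡g = refl
Σ<-cong (suc n) f≡g = cong₂ ℤ._+_ (Σ<-cong n (λ i i<n → f≡g i (ℕₚ.m<n⇒m<1+n i<n))) (f≡g n ℕₚ.≤-refl)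

Σ<-zero : ∀ n {f : ℕ → ℤ} → (∀ i → i < n → f i ≡ + 0) → Σ< n f ≡ + 0
Σ<-zero zero    f≡0 = refl
Σ<-zero (suc n) f≡0 = cong₂ ℤ._+_ (Σ<-zero n (λ i i<n → f≡0 i (ℕₚ.m<n⇒m<1+n i<n))) (f≡0 n ℕₚ.≤-refl)

Σ<-head : ∀ n (f : ℕ → ℤ) → Σ< (suc n) f ≡ f 0 ℤ.+ Σ< n (f ∘ suc)
Σ<-head zero    f = ℤₚ.+-comm (+ 0) (f 0)
Σ<-head (suc n) f = trans (cong (ℤ._+ f (suc n)) (Σ<-head n f)) (ℤₚ.+-assoc (f 0) _ _)

Σ<-extend : ∀ {m n} (f : ℕ → ℤ) → m ≤ n → (∀ i → m ≤ i → i < n → f i ≡ + 0) → Σ< n f ≡ Σ< m f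
Σ<-extend {m} {zero}  f z≤n     tail≡0 = refl
Σ<-extend {m} {suc n} f m≤1+n tail≡0 with ℕₚ.m≤n⇒m<n∨m≡n m≤1+n
... | inj₂ refl = refl
... | inj₁ m<1+n = begin
  Σ< n f ℤ.+ f n ≡⟨ cong₂ ℤ._+_ (Σ<-extend f m≤n (λ i m≤i i<n → tail≡0 i m≤i (ℕₚ.m<n⇒m<1+n i<n)))
                                (tail≡0 n m≤n ℕₚ.≤-refl) ⟩
  Σ< m f ℤ.+ + 0 ≡⟨ ℤₚ.+-identityʳ _ ⟩
  Σ< m f         ∎
  where
  open ≡-Reasoning
  m≤n = ℕₚ.≤-pred m<1+n

Σ<-distrib-+ : ∀ n (f g : ℕ → ℤ) → Σ< n (λ i → f i ℤ.+ g i) ≡ Σ< n f ℤ.+ Σ< n g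
Σ<-distrib-+ zero    f g = refl
Σ<-distrib-+ (suc n) f g =
  trans (cong (ℤ._+ (f n ℤ.+ g n)) (Σ<-distrib-+ n f g)) (interchange (Σ< n f) (Σ< n g) (f n) (g n))

*-distribˡ-Σ< : ∀ n c (f : ℕ → ℤ) → c ℤ.* Σ< n f ≡ Σ< n (λ i → c ℤ.* f i)
*-distribˡ-Σ< zero    c f = ℤₚ.*-zeroʳ c
*-distribˡ-Σ< (suc n) c f =
  trans (ℤₚ.*-distribˡ-+ c (Σ< n f) (f n)) (cong (ℤ._+ (c ℤ.* f n)) (*-distribˡ-Σ< n c f))

*-distribʳ-Σ< : ∀ n c (f : ℕ → ℤ) → Σ< n f ℤ.* c ≡ Σ< n (λ i → f i ℤ.* c)
*-distribʳ-Σ< n c f = trans (ℤₚ.*-comm (Σ< n f) c)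
  (trans (*-distribˡ-Σ< n c f) (Σ<-cong n (λ i _ → ℤₚ.*-comm c (f i))))

Σ<-comm : ∀ m n (f : ℕ → ℕ → ℤ) → Σ< m (λ i → Σ< n (f i)) ≡ Σ< n (λ j → Σ< m (λ i → f i j))
Σ<-comm zero    n f = sym (Σ<-zero n (λ _ _ → refl))
Σ<-comm (suc m) n f = trans (cong (ℤ._+ Σ< n (f m)) (Σ<-comm m n f))
                            (sym (Σ<-distrib-+ n (λ j → Σ< m (λ i → f i j)) (f m)))

Σ<-reverse : ∀ k (f : ℕ → ℤ) → Σ< (suc k) f ≡ Σ< (suc k) (λ i → f (k ∸ i))
Σ<-reverse zero    f = refl
Σ<-reverse (suc k) f = begin
  Σ< (suc k) f ℤ.+ f (suc k)                  ≡⟨ cong (ℤ._+ f (suc k)) (Σ<-reverse k f) ⟩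
  Σ< (suc k) (λ i → f (k ∸ i)) ℤ.+ f (suc k)  ≡⟨ ℤₚ.+-comm _ (f (suc k)) ⟩
  f (suc k) ℤ.+ Σ< (suc k) (λ i → f (k ∸ i))  ≡⟨ Σ<-head (suc k) (λ i → f (suc k ∸ i)) ⟨
  Σ< (suc (suc k)) (λ i → f (suc k ∸ i))      ∎
  where open ≡-Reasoning

-- Both sides sum H j l r over the triples with j + l + r = k.
Σ<-triangle : ∀ k (H : ℕ → ℕ → ℕ → ℤ) →
  Σ< (suc k) (λ i → Σ< (suc i) (λ j → H j (i ∸ j) (k ∸ i))) ≡
  Σ< (suc k) (λ j → Σ< (suc (k ∸ j)) (λ l → H j l (k ∸ j ∸ l)))
Σ<-triangle zero    H = refl
Σ<-triangle (suc k) H = begin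
  Σ< (suc (suc k)) (λ i → Σ< (suc i) (λ j → H j (i ∸ j) (suc k ∸ i)))
    ≡⟨ Σ<-head (suc k) _ ⟩
  (+ 0 ℤ.+ a) ℤ.+ Σ< (suc k) (λ i → Σ< (suc (suc i)) (λ j → H j (suc i ∸ j) (k ∸ i)))
    ≡⟨ cong₂ ℤ._+_ (ℤₚ.+-identityˡ a) (Σ<-cong (suc k) (λ i _ → Σ<-head (suc i) _)) ⟩
  a ℤ.+ Σ< (suc k) (λ i → H 0 (suc i) (k ∸ i) ℤ.+ Σ< (suc i) (λ j → H (suc j) (i ∸ j) (k ∸ i)))
    ≡⟨ cong (λ s → a ℤ.+ s) (Σ<-distrib-+ (suc k) _ _) ⟩
  a ℤ.+ (b ℤ.+ Σ< (suc k) (λ i → Σ< (suc i) (λ j → H (suc j) (i ∸ j) (k ∸ i))))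
    ≡⟨ cong (λ s → a ℤ.+ (b ℤ.+ s)) (Σ<-triangle k (H ∘ suc)) ⟩
  a ℤ.+ (b ℤ.+ c)
    ≡⟨ ℤₚ.+-assoc a b c ⟨
  (a ℤ.+ b) ℤ.+ c
    ≡⟨ cong (ℤ._+ c) (Σ<-head (suc k) (λ l → H 0 l (suc k ∸ l))) ⟨
  Σ< (suc (suc k)) (λ l → H 0 l (suc k ∸ l)) ℤ.+ c
    ≡⟨ Σ<-head (suc k) _ ⟨
  Σ< (suc (suc k)) (λ j → Σ< (suc (suc k ∸ j)) (λ l → H j l (suc k ∸ j ∸ l)))
    ∎
  where
  open ≡-Reasoning
  a = H 0 0 (suc k)
  b = Σ< (suc k) (λ i → H 0 (suc i) (k ∸ i))
  c = Σ< (suc k) (λ j → Σ< (suc (k ∸ j)) (λ l → H (suc j) l (k ∸ j ∸ l)))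

-- The ring of power series

≋-isEquivalence : IsEquivalence _≋_
≋-isEquivalence = record
  { refl  = λ _ → refl
  ; sym   = λ f≋g k → sym (f≋g k)
  ; trans = λ f≋g g≋h k → trans (f≋g k) (g≋h k)
  }

open IsEquivalence ≋-isEquivalence
  using () renaming (refl to ≋-refl; sym to ≋-sym; trans to ≋-trans)

≋-reflexive : ∀ {f g} → f ≡ g → f ≋ g
≋-reflexive refl = ≋-refl

≋-setoid : Setoid _ _
≋-setoid = record { isEquivalence = ≋-isEquivalence }

module ≋-Reasoning = Relation.Binary.Reasoning.Setoid ≋-setoid

neg : PS → PS
neg f k = ℤ.- f k

⊕-cong : ∀ {f f′ g g′} → f ≋ f′ → g ≋ g′ → f ⊕ g ≋ f′ ⊕ g′
⊕-cong f≋f′ g≋g′ k = cong₂ ℤ._+_ (f≋f′ k) (g≋g′ k)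

⊛-cong : ∀ {f f′ g g′} → f ≋ f′ → g ≋ g′ → f ⊛ g ≋ f′ ⊛ g′
⊛-cong f≋f′ g≋g′ k = Σ<-cong (suc k) (λ i _ → cong₂ ℤ._*_ (f≋f′ i) (g≋g′ (k ∸ i)))

⊕-congˡ : ∀ f {g g′} → g ≋ g′ → f ⊕ g ≋ f ⊕ g′
⊕-congˡ f = ⊕-cong (≋-refl {f})

⊕-congʳ : ∀ g {f f′} → f ≋ f′ → f ⊕ g ≋ f′ ⊕ g
⊕-congʳ g f≋f′ = ⊕-cong f≋f′ (≋-refl {g})

⊖-cong : ∀ {f f′ g g′} → f ≋ f′ → g ≋ g′ → f ⊖ g ≋ f′ ⊖ g′
⊖-cong f≋f′ g≋g′ k = cong₂ ℤ._-_ (f≋f′ k) (g≋g′ k)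

⊖-congˡ : ∀ f {g g′} → g ≋ g′ → f ⊖ g ≋ f ⊖ g′
⊖-congˡ f = ⊖-cong (≋-refl {f})

⊖-congʳ : ∀ g {f f′} → f ≋ f′ → f ⊖ g ≋ f′ ⊖ g
⊖-congʳ g f≋f′ = ⊖-cong f≋f′ (≋-refl {g})

⊛-congˡ : ∀ f {g g′} → g ≋ g′ → f ⊛ g ≋ f ⊛ g′
⊛-congˡ f = ⊛-cong (≋-refl {f})

⊛-congʳ : ∀ g {f f′} → f ≋ f′ → f ⊛ g ≋ f′ ⊛ g
⊛-congʳ g f≋f′ = ⊛-cong f≋f′ (≋-refl {g})

⊛-comm : ∀ f g → f ⊛ g ≋ g ⊛ f
⊛-comm f g k = trans (Σ<-reverse k _) (Σ<-cong (suc k) swap)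
  where
  swap : ∀ i → i < suc k → f (k ∸ i) ℤ.* g (k ∸ (k ∸ i)) ≡ g i ℤ.* f (k ∸ i)
  swap i i≤k rewrite ℕₚ.m∸[m∸n]≡n (ℕₚ.≤-pred i≤k) = ℤₚ.*-comm (f (k ∸ i)) (g i)

⊛-assoc : ∀ f g h → (f ⊛ g) ⊛ h ≋ f ⊛ (g ⊛ h)
⊛-assoc f g h k = begin
  Σ< (suc k) (λ i → Σ< (suc i) (λ j → f j ℤ.* g (i ∸ j)) ℤ.* h (k ∸ i))
    ≡⟨ Σ<-cong (suc k) (λ i _ → *-distribʳ-Σ< (suc i) (h (k ∸ i)) _) ⟩
  Σ< (suc k) (λ i → Σ< (suc i) (λ j → f j ℤ.* g (i ∸ j) ℤ.* h (k ∸ i)))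
    ≡⟨ Σ<-triangle k (λ j l r → f j ℤ.* g l ℤ.* h r) ⟩
  Σ< (suc k) (λ j → Σ< (suc (k ∸ j)) (λ l → f j ℤ.* g l ℤ.* h (k ∸ j ∸ l)))
    ≡⟨ Σ<-cong (suc k) (λ j _ → Σ<-cong (suc (k ∸ j)) (λ l _ → ℤₚ.*-assoc (f j) _ _)) ⟩
  Σ< (suc k) (λ j → Σ< (suc (k ∸ j)) (λ l → f j ℤ.* (g l ℤ.* h (k ∸ j ∸ l))))
    ≡⟨ Σ<-cong (suc k) (λ j _ → *-distribˡ-Σ< (suc (k ∸ j)) (f j) _) ⟨
  Σ< (suc k) (λ j → f j ℤ.* Σ< (suc (k ∸ j)) (λ l → g l ℤ.* h (k ∸ j ∸ l)))
    ∎
  where open ≡-Reasoning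

⊛-distribˡ-⊕ : ∀ f g h → f ⊛ (g ⊕ h) ≋ f ⊛ g ⊕ f ⊛ h
⊛-distribˡ-⊕ f g h k = trans (Σ<-cong (suc k) (λ i _ → ℤₚ.*-distribˡ-+ (f i) (g (k ∸ i)) (h (k ∸ i))))
                             (Σ<-distrib-+ (suc k) _ _)

⊛-distribʳ-⊕ : ∀ f g h → (g ⊕ h) ⊛ f ≋ g ⊛ f ⊕ h ⊛ f
⊛-distribʳ-⊕ f g h =
  ≋-trans (⊛-comm (g ⊕ h) f) (≋-trans (⊛-distribˡ-⊕ f g h) (⊕-cong (⊛-comm f g) (⊛-comm f h)))

⊛-identityˡ : ∀ f → one ⊛ f ≋ f
⊛-identityˡ f k = begin
  Σ< (suc k) (λ i → one i ℤ.* f (k ∸ i))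
    ≡⟨ Σ<-head k _ ⟩
  + 1 ℤ.* f k ℤ.+ Σ< k (λ i → + 0 ℤ.* f (k ∸ suc i))
    ≡⟨ cong₂ ℤ._+_ (ℤₚ.*-identityˡ (f k)) (Σ<-zero k (λ _ _ → refl)) ⟩
  f k ℤ.+ + 0
    ≡⟨ ℤₚ.+-identityʳ (f k) ⟩
  f k
    ∎
  where open ≡-Reasoning

PS-commutativeRing : CommutativeRing _ _
PS-commutativeRing = record
  { Carrier = PS
  ; _≈_ = _≋_
  ; _+_ = _⊕_
  ; _*_ = _⊛_
  ; -_ = neg
  ; 0# = zeroPS
  ; 1# = one
  ; isCommutativeRing = record
    { isRing = record
      { +-isAbelianGroup = record
        { isGroup = record
          { isMonoid = record
            { isSemigroup = record
              { isMagma = record { isEquivalence = ≋-isEquivalence ; ∙-cong = ⊕-cong }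
              ; assoc = λ f g h k → ℤₚ.+-assoc (f k) (g k) (h k)
              }
            ; identity = (λ f k → ℤₚ.+-identityˡ (f k)) , (λ f k → ℤₚ.+-identityʳ (f k))
            }
          ; inverse = (λ f k → ℤₚ.+-inverseˡ (f k)) , (λ f k → ℤₚ.+-inverseʳ (f k))
          ; ⁻¹-cong = λ f≋g k → cong ℤ.-_ (f≋g k)
          }
        ; comm = λ f g k → ℤₚ.+-comm (f k) (g k)
        }
      ; *-cong = ⊛-cong
      ; *-assoc = ⊛-assoc
      ; *-identity = ⊛-identityˡ , (λ f → ≋-trans (⊛-comm f one) (⊛-identityˡ f))
      ; distrib = ⊛-distribˡ-⊕ , ⊛-distribʳ-⊕
      }
    ; *-comm = ⊛-comm
    }
  }

⊛-zeroʳ : ∀ f → f ⊛ zeroPS ≋ zeroPS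
⊛-zeroʳ f k = Σ<-zero (suc k) (λ i _ → ℤₚ.*-zeroʳ (f i))

⊕-identityˡ : ∀ f → zeroPS ⊕ f ≋ f
⊕-identityˡ f k = ℤₚ.+-identityˡ (f k)

⊕-assoc : ∀ f g h → f ⊕ g ⊕ h ≋ f ⊕ (g ⊕ h)
⊕-assoc f g h k = ℤₚ.+-assoc (f k) (g k) (h k)

⊕-identityʳ : ∀ f → f ⊕ zeroPS ≋ f
⊕-identityʳ f k = ℤₚ.+-identityʳ (f k)

⊛-vanishʳ : ∀ f {g} → g ≋ zeroPS → f ⊛ g ≋ zeroPS
⊛-vanishʳ f g≋0 = ≋-trans (⊛-congˡ f g≋0) (⊛-zeroʳ f)

⊛-vanishˡ : ∀ g {f} → f ≋ zeroPS → f ⊛ g ≋ zeroPS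
⊛-vanishˡ g {f} f≋0 = ≋-trans (⊛-comm f g) (⊛-vanishʳ g f≋0)

⊛-assoc₃ : ∀ f g h i → f ⊛ g ⊛ h ⊛ i ≋ f ⊛ (g ⊛ h ⊛ i)
⊛-assoc₃ f g h i = ≋-trans (⊛-congʳ i (⊛-assoc f g h)) (⊛-assoc f (g ⊛ h) i)

const-⊛ : ∀ a b → const (a ℤ.* b) ≋ const a ⊛ const b
const-⊛ a b zero    = sym (ℤₚ.+-identityˡ (a ℤ.* b))
const-⊛ a b (suc k) = sym (Σ<-zero (suc (suc k)) vanish)
  where
  vanish : ∀ i → i < suc (suc k) → const a i ℤ.* const b (suc k ∸ i) ≡ + 0
  vanish zero    _ = ℤₚ.*-zeroʳ a
  vanish (suc i) _ = refl

const-homomorphism : ℤ.+-*-rawRing -Raw-AlmostCommutative⟶ fromCommutativeRing PS-commutativeRing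
const-homomorphism = record
  { ⟦_⟧    = const
  ; +-homo = λ { a b zero → refl ; a b (suc k) → refl }
  ; *-homo = const-⊛
  ; -‿homo = λ { a zero → refl ; a (suc k) → refl }
  ; 0-homo = λ { zero → refl ; (suc k) → refl }
  ; 1-homo = λ { zero → refl ; (suc k) → refl }
  }

const-≟ : ∀ a b → Maybe (const a ≋ const b)
const-≟ a b with a ℤ.≟ b
... | yes a≡b = just (≋-reflexive (cong const a≡b))
... | no _    = nothing

open RingSolver ℤ.+-*-rawRing (fromCommutativeRing PS-commutativeRing) const-homomorphism const-≟
  using (solve; _:=_; _:+_; _:*_; _:-_; :-_; con)

scale-as-const : ∀ c f → scale c f ≋ const c ⊛ f
scale-as-const c f k = sym (trans (Σ<-head k _)
  (trans (cong (λ z → c ℤ.* f k ℤ.+ z) (Σ<-zero k (λ _ _ → refl))) (ℤₚ.+-identityʳ (c ℤ.* f k))))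

const-neg : ∀ c → const (ℤ.- c) ≋ neg (const c)
const-neg c zero    = refl
const-neg c (suc k) = refl

zeroPS≋const0 : zeroPS ≋ const (+ 0)
zeroPS≋const0 zero    = refl
zeroPS≋const0 (suc k) = refl

-- Monomials and geometric series

mono-zero : mono 0 ≋ one
mono-zero zero    = refl
mono-zero (suc k) = refl

mono-suc-⊛ : ∀ e f k → (mono (suc e) ⊛ f) (suc k) ≡ (mono e ⊛ f) k
mono-suc-⊛ e f k = trans (Σ<-head (suc k) _) (ℤₚ.+-identityˡ _)

mono-⊛-below : ∀ e f {k} → k < e → (mono e ⊛ f) k ≡ + 0
mono-⊛-below (suc e) f {zero}  _         = refl
mono-⊛-below (suc e) f {suc k} (s≤s k<e) = trans (mono-suc-⊛ e f k) (mono-⊛-below e f k<e)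

mono-⊛-shift : ∀ e f k → (mono e ⊛ f) (e + k) ≡ f k
mono-⊛-shift zero    f k = trans (⊛-congʳ f mono-zero k) (⊛-identityˡ f k)
mono-⊛-shift (suc e) f k = trans (mono-suc-⊛ e f (e + k)) (mono-⊛-shift e f k)

mono-+ : ∀ a b → mono a ⊛ mono b ≋ mono (a + b)
mono-+ zero    b k       = mono-⊛-shift 0 (mono b) k
mono-+ (suc a) b zero    = refl
mono-+ (suc a) b (suc k) = trans (mono-suc-⊛ a (mono b) k) (mono-+ a b k)

mono-cong : ∀ {a b} → a ≡ b → mono a ≋ mono b
mono-cong a≡b k = cong (λ e → mono e k) a≡b

mono-split : ∀ a b {c} → a + b ≡ c → mono c ≋ mono a ⊛ mono b
mono-split a b a+b≡c = ≋-trans (mono-cong (sym a+b≡c)) (≋-sym (mono-+ a b))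

mono-⊛-regroup : ∀ a b c d → a + b ≡ c + d → mono a ⊛ mono b ≋ mono c ⊛ mono d
mono-⊛-regroup a b c d eq = ≋-trans (mono-+ a b) (≋-trans (mono-cong eq) (≋-sym (mono-+ c d)))

⊛-scaleˡ : ∀ c f g → scale c f ⊛ g ≋ scale c (f ⊛ g)
⊛-scaleˡ c f g k = trans (Σ<-cong (suc k) (λ i _ → ℤₚ.*-assoc c (f i) (g (k ∸ i))))
                         (sym (*-distribˡ-Σ< (suc k) c _))

geometric-inverse : ∀ j c (G : PS) → G 0 ≡ + 1 → (∀ k → k < j → G (suc k) ≡ + 0) →
                    (∀ k → G (suc j + k) ≡ ℤ.- (c ℤ.* G k)) →
                    (one ⊕ scale c (mono (suc j))) ⊛ G ≋ one
geometric-inverse j c G G0≡1 gap recurrence k =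
  trans (trans (⊛-distribʳ-⊕ G one _ k) (cong₂ ℤ._+_ (⊛-identityˡ G k) (⊛-scaleˡ c _ G k))) (coeff k)
  where
  drop-shifted : ∀ {k} → k < suc j → G k ℤ.+ c ℤ.* (mono (suc j) ⊛ G) k ≡ G k
  drop-shifted {k} k≤j = trans (cong (λ x → G k ℤ.+ c ℤ.* x) (mono-⊛-below (suc j) G k≤j))
                               (trans (cong (λ x → G k ℤ.+ x) (ℤₚ.*-zeroʳ c)) (ℤₚ.+-identityʳ (G k)))
  coeff : ∀ k → G k ℤ.+ c ℤ.* (mono (suc j) ⊛ G) k ≡ one k
  coeff zero = trans (drop-shifted (s≤s z≤n)) G0≡1
  coeff (suc k) with ℕₚ.<-≤-connex k j
  ... | inj₁ k<j = trans (drop-shifted (s≤s k<j)) (gap k k<j)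
  ... | inj₂ j≤k with ℕₚ.m≤n⇒∃[o]m+o≡n j≤k
  ...   | o , refl = trans (cong₂ (λ x y → x ℤ.+ c ℤ.* y) (recurrence o) (mono-⊛-shift (suc j) G o))
                           (ℤₚ.+-inverseˡ (c ℤ.* G o))

[n+k]%n≡k%n : ∀ j k → (suc j + k) % suc j ≡ k % suc j
[n+k]%n≡k%n j k = trans (cong (_% suc j) (ℕₚ.+-comm (suc j) k)) ([m+n]%n≡m%n k (suc j))

invOneMinusQ-inverse : ∀ j → oneMinusQ j ⊛ invOneMinusQ j ≋ one
invOneMinusQ-inverse j = ≋-trans (⊛-congʳ (invOneMinusQ j) as-geometric)
  (geometric-inverse j -[1+ 0 ] (invOneMinusQ j) refl gap recurrence)
  where
  as-geometric : oneMinusQ j ≋ one ⊕ scale -[1+ 0 ] (mono (suc j))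
  as-geometric k = cong (λ x → one k ℤ.+ x) (sym (ℤₚ.-1*i≡-i (mono (suc j) k)))
  gap : ∀ k → k < j → invOneMinusQ j (suc k) ≡ + 0
  gap k k<j rewrite m<n⇒m%n≡m (s≤s k<j) = refl
  recurrence : ∀ k → invOneMinusQ j (suc j + k) ≡ ℤ.- (-[1+ 0 ] ℤ.* invOneMinusQ j k)
  recurrence k rewrite [n+k]%n≡k%n j k | ℤₚ.-1*i≡-i (invOneMinusQ j k) =
    sym (ℤₚ.neg-involutive (invOneMinusQ j k))

alternating : ℕ → ℤ
alternating t = if t % 2 ℕ.≡ᵇ 0 then + 1 else -[1+ 0 ]

alternating-suc : ∀ t → alternating (suc t) ≡ ℤ.- alternating t
alternating-suc zero          = refl
alternating-suc (suc zero)    = refl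
alternating-suc (suc (suc t)) rewrite [n+k]%n≡k%n 1 (suc t) | [n+k]%n≡k%n 1 t = alternating-suc t

invOnePlusQ-inverse : ∀ j → onePlusQ (suc j) ⊛ invOnePlusQ j ≋ one
invOnePlusQ-inverse j = ≋-trans (⊛-congʳ (invOnePlusQ j) as-geometric)
  (geometric-inverse j (+ 1) (invOnePlusQ j) refl gap recurrence)
  where
  as-geometric : onePlusQ (suc j) ≋ one ⊕ scale (+ 1) (mono (suc j))
  as-geometric k = cong (λ x → one k ℤ.+ x) (sym (ℤₚ.*-identityˡ (mono (suc j) k)))
  gap : ∀ k → k < j → invOnePlusQ j (suc k) ≡ + 0
  gap k k<j rewrite m<n⇒m%n≡m (s≤s k<j) = refl
  quotient : ∀ k → (suc j + k) / suc j ≡ suc (k / suc j)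
  quotient k = trans (m/n≡1+[m∸n]/n (ℕₚ.m≤m+n (suc j) k)) (cong (λ r → suc (r / suc j)) (ℕₚ.m+n∸m≡n (suc j) k))
  recurrence : ∀ k → invOnePlusQ j (suc j + k) ≡ ℤ.- (+ 1 ℤ.* invOnePlusQ j k)
  recurrence k rewrite [n+k]%n≡k%n j k | quotient k | ℤₚ.*-identityˡ (invOnePlusQ j k) with k % suc j ℕ.≡ᵇ 0
  ... | true  = alternating-suc (k / suc j)
  ... | false = refl

cancel-inverse : ∀ f g g⁻¹ → g ⊛ g⁻¹ ≋ one → f ≋ f ⊛ g⁻¹ ⊛ g
cancel-inverse f g g⁻¹ g⊛g⁻¹≋1 = ≋-sym (begin
  f ⊛ g⁻¹ ⊛ g   ≈⟨ ⊛-assoc f g⁻¹ g ⟩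
  f ⊛ (g⁻¹ ⊛ g) ≈⟨ ⊛-congˡ f (≋-trans (⊛-comm g⁻¹ g) g⊛g⁻¹≋1) ⟩
  f ⊛ one       ≈⟨ ⊛-comm f one ⟩
  one ⊛ f       ≈⟨ ⊛-identityˡ f ⟩
  f             ∎)
  where open ≋-Reasoning

-- Congruences modulo powers of q, and infinite sums

infix 4 _≋_mod-q^_
_≋_mod-q^_ : PS → PS → ℕ → Set
f ≋ g mod-q^ a = ∀ k → k < a → f k ≡ g k

mod-q^-weaken : ∀ {a b f g} → b ≤ a → f ≋ g mod-q^ a → f ≋ g mod-q^ b
mod-q^-weaken b≤a f≡g k k<b = f≡g k (ℕₚ.<-≤-trans k<b b≤a)

mono-⊛-≋0 : ∀ e f → mono e ⊛ f ≋ zeroPS mod-q^ e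
mono-⊛-≋0 e f k = mono-⊛-below e f

⊛-congˡ-mod : ∀ {a} f {g g′} → g ≋ g′ mod-q^ a → f ⊛ g ≋ f ⊛ g′ mod-q^ a
⊛-congˡ-mod f g≡g′ k k<a =
  Σ<-cong (suc k) (λ i _ → cong (f i ℤ.*_) (g≡g′ (k ∸ i) (ℕₚ.≤-<-trans (ℕₚ.m∸n≤m k i) k<a)))

⊛-≋0-mod : ∀ {a f} g → f ≋ zeroPS mod-q^ a → f ⊛ g ≋ zeroPS mod-q^ a
⊛-≋0-mod {f = f} g f≡0 k k<a = trans (⊛-comm f g k) (trans (⊛-congˡ-mod g f≡0 k k<a) (⊛-zeroʳ g k))

sumPS-cong : ∀ n {f g : ℕ → PS} → (∀ i → i < n → f i ≋ g i) → sumPS n f ≋ sumPS n g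
sumPS-cong n f≋g k = Σ<-cong n (λ i i<n → f≋g i i<n k)

sumPS-zero : ∀ n {f : ℕ → PS} → (∀ i → i < n → f i ≋ zeroPS) → sumPS n f ≋ zeroPS
sumPS-zero n f≋0 k = Σ<-zero n (λ i i<n → f≋0 i i<n k)

sumPS-head : ∀ n (f : ℕ → PS) → sumPS (suc n) f ≋ f 0 ⊕ sumPS n (f ∘ suc)
sumPS-head n f k = Σ<-head n _

sumPS-extend : ∀ {m n} (f : ℕ → PS) → m ≤ n → (∀ i → m ≤ i → i < n → f i ≋ zeroPS) →
               sumPS n f ≋ sumPS m f
sumPS-extend f m≤n tail≋0 k = Σ<-extend _ m≤n (λ i m≤i i<n → tail≋0 i m≤i i<n k)

sumPS-distrib-⊕ : ∀ n (f g : ℕ → PS) → sumPS n (λ i → f i ⊕ g i) ≋ sumPS n f ⊕ sumPS n g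
sumPS-distrib-⊕ n f g k = Σ<-distrib-+ n _ _

⊛-distribˡ-sumPS : ∀ n h (f : ℕ → PS) → h ⊛ sumPS n f ≋ sumPS n (λ i → h ⊛ f i)
⊛-distribˡ-sumPS zero    h f = ⊛-zeroʳ h
⊛-distribˡ-sumPS (suc n) h f =
  ≋-trans (⊛-distribˡ-⊕ h (sumPS n f) (f n)) (⊕-congʳ (h ⊛ f n) (⊛-distribˡ-sumPS n h f))

Summable : (ℕ → PS) → Set
Summable f = ∀ n → f n ≋ zeroPS mod-q^ n

-- Σ_{n ≥ 0} f n: for summable f only the terms n ≤ k contribute to the coefficient of q^k.
Σ∞ : (ℕ → PS) → PS
Σ∞ f k = Σ< (suc k) (λ n → f n k)

Σ∞-cong : ∀ {f g} → (∀ n → f n ≋ g n) → Σ∞ f ≋ Σ∞ g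
Σ∞-cong f≋g k = Σ<-cong (suc k) (λ n _ → f≋g n k)

Σ∞-distrib-⊕ : ∀ f g → Σ∞ (λ n → f n ⊕ g n) ≋ Σ∞ f ⊕ Σ∞ g
Σ∞-distrib-⊕ f g k = Σ<-distrib-+ (suc k) _ _

⊛-distribˡ-Σ∞ : ∀ h {f} → Summable f → h ⊛ Σ∞ f ≋ Σ∞ (λ n → h ⊛ f n)
⊛-distribˡ-Σ∞ h {f} f-summable k = sym (begin
  Σ< (suc k) (λ n → Σ< (suc k) (λ i → h i ℤ.* f n (k ∸ i)))
    ≡⟨ Σ<-comm (suc k) (suc k) _ ⟩
  Σ< (suc k) (λ i → Σ< (suc k) (λ n → h i ℤ.* f n (k ∸ i)))
    ≡⟨ Σ<-cong (suc k) (λ i i≤k → trans (sym (*-distribˡ-Σ< (suc k) (h i) _))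
                                        (cong (h i ℤ.*_) (truncate i))) ⟩
  Σ< (suc k) (λ i → h i ℤ.* Σ< (suc (k ∸ i)) (λ n → f n (k ∸ i)))
    ∎)
  where
  open ≡-Reasoning
  truncate : ∀ i → Σ< (suc k) (λ n → f n (k ∸ i)) ≡ Σ< (suc (k ∸ i)) (λ n → f n (k ∸ i))
  truncate i = Σ<-extend _ (s≤s (ℕₚ.m∸n≤m k i)) (λ n k∸i<n _ → f-summable n (k ∸ i) k∸i<n)

Σ∞-head : ∀ {f} → Summable f → Σ∞ f ≋ f 0 ⊕ Σ∞ (f ∘ suc)
Σ∞-head {f} f-summable k = trans (Σ<-head k _) (cong (λ s → f 0 k ℤ.+ s) (sym last-vanishes))
  where
  last-vanishes : Σ< (suc k) (λ n → f (suc n) k) ≡ Σ< k (λ n → f (suc n) k)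
  last-vanishes = trans (cong (λ x → Σ< k (λ n → f (suc n) k) ℤ.+ x) (f-summable (suc k) k ℕₚ.≤-refl))
                        (ℤₚ.+-identityʳ _)

Σ∞-≋0-mod : ∀ {a} f → (∀ n → f n ≋ zeroPS mod-q^ a) → Σ∞ f ≋ zeroPS mod-q^ a
Σ∞-≋0-mod f f≡0 k k<a = Σ<-zero (suc k) (λ n _ → f≡0 n k k<a)

Σ∞-difference : ∀ {f g} → Summable f → Summable g → f 0 ≋ g 0 →
                Σ∞ f ≋ Σ∞ g ⊕ Σ∞ (λ n → f (suc n) ⊖ g (suc n))
Σ∞-difference {f} {g} f-summable g-summable f₀≋g₀ = begin
  Σ∞ f                      ≈⟨ Σ∞-cong (λ n → solve 2 (λ a b → a := b :+ (a :- b)) ≋-refl (f n) (g n)) ⟩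
  Σ∞ (λ n → g n ⊕ d n)      ≈⟨ Σ∞-distrib-⊕ g d ⟩
  Σ∞ g ⊕ Σ∞ d               ≈⟨ ⊕-congˡ (Σ∞ g) (Σ∞-head d-summable) ⟩
  Σ∞ g ⊕ (d 0 ⊕ Σ∞ (d ∘ suc)) ≈⟨ ⊕-congˡ (Σ∞ g) (⊕-congʳ (Σ∞ (d ∘ suc)) d₀≋0) ⟩
  Σ∞ g ⊕ (zeroPS ⊕ Σ∞ (d ∘ suc)) ≈⟨ ⊕-congˡ (Σ∞ g) (⊕-identityˡ (Σ∞ (d ∘ suc))) ⟩
  Σ∞ g ⊕ Σ∞ (d ∘ suc)       ∎
  where
  open ≋-Reasoning
  d : ℕ → PS
  d n = f n ⊖ g n
  d-summable : Summable d
  d-summable n k k<n = cong₂ ℤ._-_ (f-summable n k k<n) (g-summable n k k<n)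
  d₀≋0 : d 0 ≋ zeroPS
  d₀≋0 k = trans (cong (λ x → f 0 k ℤ.- x) (sym (f₀≋g₀ k))) (ℤₚ.+-inverseʳ (f 0 k))

-- The left-hand side

invNegQPochPred-step : ∀ k → invNegQPochPred k ≋ invNegQPochPred (suc k) ⊛ onePlusQ k
invNegQPochPred-step zero    = ≋-sym (≋-trans (⊛-identityˡ (onePlusQ 0)) λ { zero → refl ; (suc k) → refl })
invNegQPochPred-step (suc j) =
  cancel-inverse (invNegQPochPred (suc j)) (onePlusQ (suc j)) (invOnePlusQ j) (invOnePlusQ-inverse j)

invQPoch-step : ∀ n → invQPoch n ≋ invQPoch (suc n) ⊛ oneMinusQ n
invQPoch-step n = cancel-inverse (invQPoch n) (oneMinusQ n) (invOneMinusQ n) (invOneMinusQ-inverse n)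

Φ-term : ℕ → ℕ → ℕ → PS
Φ-term c j n = mono (n * n + c * n) ⊛ invNegQPochPred (j + n) ⊛ invQPoch n

Φ : ℕ → ℕ → PS
Φ c j = Σ∞ (Φ-term c j)

n≤n*n+c*n : ∀ n c → n ≤ n * n + c * n
n≤n*n+c*n zero    c = z≤n
n≤n*n+c*n (suc n) c = ℕₚ.≤-trans (ℕₚ.m≤m*n (suc n) (suc n)) (ℕₚ.m≤m+n _ _)

Φ-term-summable : ∀ c j → Summable (Φ-term c j)
Φ-term-summable c j n = mod-q^-weaken (n≤n*n+c*n n c)
  (⊛-≋0-mod (invQPoch n) (mono-⊛-≋0 (n * n + c * n) (invNegQPochPred (j + n))))

Φ-term-split-j : ∀ c j n → Φ-term c j n ≋ Φ-term c (suc j) n ⊕ mono j ⊛ Φ-term (suc c) (suc j) n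
Φ-term-split-j c j n = begin
  x ⊛ invNegQPochPred (j + n) ⊛ Q    ≈⟨ ⊛-congʳ Q (⊛-congˡ x (invNegQPochPred-step (j + n))) ⟩
  x ⊛ (N ⊛ (one ⊕ y)) ⊛ Q            ≈⟨ solve 4 (λ x N y Q → x :* (N :* (con (+ 1) :+ y)) :* Q
                                                  := x :* N :* Q :+ x :* y :* N :* Q) ≋-refl x N y Q ⟩
  x ⊛ N ⊛ Q ⊕ x ⊛ y ⊛ N ⊛ Q          ≈⟨ ⊕-congˡ (x ⊛ N ⊛ Q) (⊛-congʳ Q (⊛-congʳ N exponent)) ⟩
  x ⊛ N ⊛ Q ⊕ mono j ⊛ x′ ⊛ N ⊛ Q    ≈⟨ ⊕-congˡ (x ⊛ N ⊛ Q) (⊛-assoc₃ (mono j) x′ N Q) ⟩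
  x ⊛ N ⊛ Q ⊕ mono j ⊛ (x′ ⊛ N ⊛ Q)  ∎
  where
  open ≋-Reasoning
  x = mono (n * n + c * n)
  x′ = mono (n * n + suc c * n)
  y = mono (j + n)
  N = invNegQPochPred (suc j + n)
  Q = invQPoch n
  exponent : x ⊛ y ≋ mono j ⊛ x′
  exponent = mono-⊛-regroup _ _ _ _ (arithmetic n c j)
    where
    arithmetic : ∀ n c j → n * n + c * n + (j + n) ≡ j + (n * n + suc c * n)
    arithmetic = solve-∀

Φ-term-split-c₀ : ∀ c j → Φ-term c j 0 ≋ Φ-term (suc c) j 0
Φ-term-split-c₀ c j = ⊛-congʳ (invQPoch 0) (⊛-congʳ (invNegQPochPred (j + 0))
  (mono-cong (trans (ℕₚ.*-zeroʳ c) (sym (ℕₚ.*-zeroʳ (suc c))))))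

Φ-term-split-c : ∀ c j n →
  Φ-term c j (suc n) ⊖ Φ-term (suc c) j (suc n) ≋ mono (suc c) ⊛ Φ-term (suc (suc c)) (suc j) n
Φ-term-split-c c j n = begin
  x ⊛ N ⊛ Q′ ⊖ x₁ ⊛ N ⊛ Q′
    ≈⟨ ⊖-congˡ (x ⊛ N ⊛ Q′) (⊛-congʳ Q′ (⊛-congʳ N x₁≋x⊛y)) ⟩
  x ⊛ N ⊛ Q′ ⊖ x ⊛ y ⊛ N ⊛ Q′           ≈⟨ solve 4 (λ x N Q′ y → x :* N :* Q′ :- x :* y :* N :* Q′
                                                     := x :* N :* (Q′ :* (con (+ 1) :- y))) ≋-refl x N Q′ y ⟩
  x ⊛ N ⊛ (Q′ ⊛ oneMinusQ n)           ≈⟨ ⊛-congˡ (x ⊛ N) (invQPoch-step n) ⟨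
  x ⊛ N ⊛ invQPoch n                   ≈⟨ ⊛-congʳ (invQPoch n) (⊛-cong x≋qᶜ⁺¹⊛x′ N≋N′) ⟩
  mono (suc c) ⊛ x′ ⊛ N′ ⊛ invQPoch n   ≈⟨ ⊛-assoc₃ (mono (suc c)) x′ N′ (invQPoch n) ⟩
  mono (suc c) ⊛ (x′ ⊛ N′ ⊛ invQPoch n) ∎
  where
  open ≋-Reasoning
  x = mono (suc n * suc n + c * suc n)
  x₁ = mono (suc n * suc n + suc c * suc n)
  x′ = mono (n * n + suc (suc c) * n)
  y = mono (suc n)
  N = invNegQPochPred (j + suc n)
  N′ = invNegQPochPred (suc j + n)
  Q′ = invQPoch (suc n)
  N≋N′ : N ≋ N′
  N≋N′ = ≋-reflexive (cong invNegQPochPred (ℕₚ.+-suc j n))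
  x₁≋x⊛y : x₁ ≋ x ⊛ y
  x₁≋x⊛y = ≋-trans (mono-cong (arithmetic n c)) (≋-sym (mono-+ _ (suc n)))
    where
    arithmetic : ∀ n c → suc n * suc n + suc c * suc n ≡ suc n * suc n + c * suc n + suc n
    arithmetic = solve-∀
  x≋qᶜ⁺¹⊛x′ : x ≋ mono (suc c) ⊛ x′
  x≋qᶜ⁺¹⊛x′ = ≋-trans (mono-cong (arithmetic n c)) (≋-sym (mono-+ (suc c) _))
    where
    arithmetic : ∀ n c → suc n * suc n + c * suc n ≡ suc c + (n * n + suc (suc c) * n)
    arithmetic = solve-∀

Φ-split-j : ∀ c j → Φ c j ≋ Φ c (suc j) ⊕ mono j ⊛ Φ (suc c) (suc j)
Φ-split-j c j = begin
  Φ c j                                                  ≈⟨ Σ∞-cong (Φ-term-split-j c j) ⟩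
  Σ∞ (λ n → Φ-term c (suc j) n ⊕ mono j ⊛ Φ-term (suc c) (suc j) n) ≈⟨ Σ∞-distrib-⊕ _ _ ⟩
  Φ c (suc j) ⊕ Σ∞ (λ n → mono j ⊛ Φ-term (suc c) (suc j) n)
    ≈⟨ ⊕-congˡ (Φ c (suc j)) (⊛-distribˡ-Σ∞ (mono j) (Φ-term-summable (suc c) (suc j))) ⟨
  Φ c (suc j) ⊕ mono j ⊛ Φ (suc c) (suc j)               ∎
  where open ≋-Reasoning

Φ-split-c : ∀ c j → Φ c j ≋ Φ (suc c) j ⊕ mono (suc c) ⊛ Φ (suc (suc c)) (suc j)
Φ-split-c c j = begin
  Φ c j
    ≈⟨ Σ∞-difference (Φ-term-summable c j) (Φ-term-summable (suc c) j) (Φ-term-split-c₀ c j) ⟩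
  Φ (suc c) j ⊕ Σ∞ (λ n → Φ-term c j (suc n) ⊖ Φ-term (suc c) j (suc n))
    ≈⟨ ⊕-congˡ (Φ (suc c) j) (Σ∞-cong (Φ-term-split-c c j)) ⟩
  Φ (suc c) j ⊕ Σ∞ (λ n → mono (suc c) ⊛ Φ-term (suc (suc c)) (suc j) n)
    ≈⟨ ⊕-congˡ (Φ (suc c) j) (⊛-distribˡ-Σ∞ (mono (suc c)) (Φ-term-summable (suc (suc c)) (suc j))) ⟨
  Φ (suc c) j ⊕ mono (suc c) ⊛ Φ (suc (suc c)) (suc j)
    ∎
  where open ≋-Reasoning

lhs-recurrence : ∀ m → lhs m ≋ (one ⊕ mono m) ⊛ lhs (suc m) ⊕ mono (suc m) ⊛ lhs (suc (suc m))
lhs-recurrence m = begin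
  F₀                                     ≈⟨ Φ-split-c m m ⟩
  A ⊕ mono (suc m) ⊛ G                   ≈⟨ ⊕-cong (Φ-split-j (suc m) m) (⊛-congʳ G (≋-sym (mono-+ 1 m))) ⟩
  (F₁ ⊕ x ⊛ G) ⊕ q ⊛ x ⊛ G               ≈⟨ solve 4 (λ F₁ x q G → F₁ :+ x :* G :+ q :* x :* G
                                                     := F₁ :+ x :* ((con (+ 1) :+ q) :* G)) ≋-refl F₁ x q G ⟩
  F₁ ⊕ x ⊛ ((one ⊕ q) ⊛ G)               ≈⟨ ⊕-congˡ F₁ (⊛-congˡ x [1+q]G) ⟩
  F₁ ⊕ x ⊛ (F₁ ⊕ q ⊛ F₂)                 ≈⟨ solve 4 (λ F₁ x q F₂ → F₁ :+ x :* (F₁ :+ q :* F₂)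
                                                     := (con (+ 1) :+ x) :* F₁ :+ q :* x :* F₂) ≋-refl F₁ x q F₂ ⟩
  (one ⊕ x) ⊛ F₁ ⊕ q ⊛ x ⊛ F₂            ≈⟨ ⊕-congˡ ((one ⊕ x) ⊛ F₁) (⊛-congʳ F₂ (mono-+ 1 m)) ⟩
  (one ⊕ x) ⊛ F₁ ⊕ mono (suc m) ⊛ F₂     ∎
  where
  open ≋-Reasoning
  q = mono 1
  x = mono m
  F₀ = Φ m m
  A = Φ (suc m) m
  F₁ = Φ (suc m) (suc m)
  G = Φ (suc (suc m)) (suc m)
  F₂ = Φ (suc (suc m)) (suc (suc m))
  H = Φ (suc (suc (suc m))) (suc (suc m))
  [1+q]G : (one ⊕ q) ⊛ G ≋ F₁ ⊕ q ⊛ F₂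
  [1+q]G = begin
    (one ⊕ q) ⊛ G                        ≈⟨ solve 2 (λ q G → (con (+ 1) :+ q) :* G := G :+ q :* G) ≋-refl q G ⟩
    G ⊕ q ⊛ G                            ≈⟨ ⊕-congˡ G (⊛-congˡ q (Φ-split-j (suc (suc m)) (suc m))) ⟩
    G ⊕ q ⊛ (F₂ ⊕ mono (suc m) ⊛ H)
      ≈⟨ solve 4 (λ G q F₂ y → G :+ q :* (F₂ :+ y) := (G :+ q :* y) :+ q :* F₂)
           ≋-refl G q F₂ (mono (suc m) ⊛ H) ⟩
    (G ⊕ q ⊛ (mono (suc m) ⊛ H)) ⊕ q ⊛ F₂
      ≈⟨ ⊕-congʳ (q ⊛ F₂) (⊕-congˡ G (≋-trans (≋-sym (⊛-assoc q (mono (suc m)) H))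
                                              (⊛-congʳ H (mono-+ 1 (suc m))))) ⟩
    (G ⊕ mono (suc (suc m)) ⊛ H) ⊕ q ⊛ F₂
      ≈⟨ ⊕-congʳ (q ⊛ F₂) (Φ-split-c (suc m) (suc m)) ⟨
    F₁ ⊕ q ⊛ F₂                          ∎

Φ-split-j₀ : ∀ c → Φ c 0 ≋ Φ c 1 ⊕ Φ (suc c) 1
Φ-split-j₀ c = ≋-trans (Φ-split-j c 0)
  (⊕-congˡ (Φ c 1) (≋-trans (⊛-congʳ (Φ (suc c) 1) mono-zero) (⊛-identityˡ (Φ (suc c) 1))))

Φ-step : ∀ c → Φ c 1 ≋ onePlusQ (suc c) ⊛ Φ (suc (suc c)) 1
Φ-step c = begin
  W₀                                 ≈⟨ solve 2 (λ a b → a := a :+ b :- b) ≋-refl W₀ W₁ ⟩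
  W₀ ⊕ W₁ ⊖ W₁                       ≈⟨ ⊖-congʳ W₁ (Φ-split-j₀ c) ⟨
  Φ c 0 ⊖ W₁                         ≈⟨ ⊖-congʳ W₁ (Φ-split-c c 0) ⟩
  Φ (suc c) 0 ⊕ y ⊛ W₂ ⊖ W₁          ≈⟨ ⊖-congʳ W₁ (⊕-congʳ (y ⊛ W₂) (Φ-split-j₀ (suc c))) ⟩
  W₁ ⊕ W₂ ⊕ y ⊛ W₂ ⊖ W₁              ≈⟨ solve 3 (λ W₁ W₂ y → W₁ :+ W₂ :+ y :* W₂ :- W₁
                                                         := (con (+ 1) :+ y) :* W₂) ≋-refl W₁ W₂ y ⟩
  (one ⊕ y) ⊛ W₂                     ∎
  where
  open ≋-Reasoning
  y = mono (suc c)
  W₀ = Φ c 1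
  W₁ = Φ (suc c) 1
  W₂ = Φ (suc (suc c)) 1

prodPS-cong : ∀ n {f g : ℕ → PS} → (∀ k → f k ≋ g k) → prodPS n f ≋ prodPS n g
prodPS-cong zero    f≋g = ≋-refl
prodPS-cong (suc n) f≋g = ⊛-cong (prodPS-cong n f≋g) (f≋g n)

Φ-iterate : ∀ c K → Φ c 1 ≋ prodPS K (λ k → onePlusQ (2 * k + suc c)) ⊛ Φ (2 * K + c) 1
Φ-iterate c zero    = ≋-sym (⊛-identityˡ (Φ c 1))
Φ-iterate c (suc K) = begin
  Φ c 1                                                     ≈⟨ Φ-iterate c K ⟩
  P ⊛ Φ (2 * K + c) 1                                       ≈⟨ ⊛-congˡ P (Φ-step (2 * K + c)) ⟩
  P ⊛ (onePlusQ (suc (2 * K + c)) ⊛ Φ (suc (suc (2 * K + c))) 1)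
    ≈⟨ ⊛-congˡ P (⊛-cong (≋-reflexive (cong onePlusQ (sym (ℕₚ.+-suc (2 * K) c))))
                          (≋-reflexive (cong (λ c′ → Φ c′ 1) (arithmetic K c)))) ⟩
  P ⊛ (onePlusQ (2 * K + suc c) ⊛ Φ (2 * suc K + c) 1)
    ≈⟨ ⊛-assoc P (onePlusQ (2 * K + suc c)) (Φ (2 * suc K + c) 1) ⟨
  P ⊛ onePlusQ (2 * K + suc c) ⊛ Φ (2 * suc K + c) 1        ∎
  where
  open ≋-Reasoning
  P = prodPS K (λ k → onePlusQ (2 * k + suc c))
  arithmetic : ∀ K c → suc (suc (2 * K + c)) ≡ 2 * suc K + c
  arithmetic = solve-∀

Φ-leading : ∀ c → Φ c 1 ≋ one mod-q^ suc c
Φ-leading c k k≤c = begin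
  Φ c 1 k
    ≡⟨ Σ∞-head (Φ-term-summable c 1) k ⟩
  Φ-term c 1 0 k ℤ.+ Σ∞ (Φ-term c 1 ∘ suc) k
    ≡⟨ cong₂ ℤ._+_ (leading-term k) (Σ∞-≋0-mod _ higher-terms k k≤c) ⟩
  one k ℤ.+ + 0
    ≡⟨ ℤₚ.+-identityʳ (one k) ⟩
  one k
    ∎
  where
  open ≡-Reasoning
  q⁰ : mono (c * 0) ≋ one
  q⁰ = ≋-trans (mono-cong (ℕₚ.*-zeroʳ c)) mono-zero
  leading-term : Φ-term c 1 0 ≋ one
  leading-term = ≋-trans (⊛-congʳ one (≋-trans (⊛-congʳ one q⁰) (⊛-identityˡ one))) (⊛-identityˡ one)
  higher-terms : ∀ n → Φ-term c 1 (suc n) ≋ zeroPS mod-q^ suc c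
  higher-terms n = mod-q^-weaken c<exponent (⊛-≋0-mod (invQPoch (suc n)) (mono-⊛-≋0 _ (invNegQPochPred (1 + suc n))))
    where
    arithmetic : ∀ n c → suc c + (n * n + n + n + c * n) ≡ suc n * suc n + c * suc n
    arithmetic = solve-∀
    c<exponent : suc c ≤ suc n * suc n + c * suc n
    c<exponent = subst (suc c ≤_) (arithmetic n c) (ℕₚ.m≤m+n (suc c) _)

Φ-product : ∀ c → Φ c 1 ≋ infProdOnePlus (λ k → 2 * k + suc c)
Φ-product c d = begin
  Φ c 1 d                         ≡⟨ Φ-iterate c (suc d) d ⟩
  (P ⊛ Φ (2 * suc d + c) 1) d     ≡⟨ ⊛-congˡ-mod P (Φ-leading (2 * suc d + c)) d (s≤s d≤bound) ⟩
  (P ⊛ one) d                     ≡⟨ ⊛-comm P one d ⟩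
  (one ⊛ P) d                     ≡⟨ ⊛-identityˡ P d ⟩
  P d                             ∎
  where
  open ≡-Reasoning
  P = prodPS (suc d) (λ k → onePlusQ (2 * k + suc c))
  d≤bound : d ≤ 2 * suc d + c
  d≤bound = ℕₚ.≤-trans (ℕₚ.n≤1+n d) (ℕₚ.≤-trans (ℕₚ.m≤m+n (suc d) _) (ℕₚ.m≤m+n _ c))

infProdOnePlus-cong : ∀ {e e′} → (∀ k → e k ≡ e′ k) → infProdOnePlus e ≋ infProdOnePlus e′
infProdOnePlus-cong e≡e′ d = prodPS-cong (suc d) (λ k → ≋-reflexive (cong onePlusQ (e≡e′ k))) d

Φ₀₁≋negQQ2 : Φ 0 1 ≋ negQQ2
Φ₀₁≋negQQ2 = ≋-trans (Φ-product 0) (infProdOnePlus-cong (λ k → ℕₚ.+-comm (2 * k) 1))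

Φ₁₁≋negQ2Q2 : Φ 1 1 ≋ negQ2Q2
Φ₁₁≋negQ2Q2 = ≋-trans (Φ-product 1) (infProdOnePlus-cong (λ k → ℕₚ.+-comm (2 * k) 2))

lhs-zero : lhs 0 ≋ negQQ2 ⊕ negQ2Q2
lhs-zero = ≋-trans (Φ-split-j₀ 0) (⊕-cong Φ₀₁≋negQQ2 Φ₁₁≋negQ2Q2)

lhs-one : lhs 1 ≋ negQ2Q2
lhs-one = Φ₁₁≋negQ2Q2

-- Gaussian polynomials

gaussℕ : ℕ → ℕ → PS
gaussℕ N M = gauss (+ N) (+ M)

gaussℕ-def : ∀ {N} M r → M + r ≡ N → gaussℕ N M ≋ qPoch N ⊛ invQPoch M ⊛ invQPoch r
gaussℕ-def M r refl rewrite dec-true (M ℕₚ.≤? M + r) (ℕₚ.m≤m+n M r) | ℕₚ.m+n∸m≡n M r = ≋-refl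

gaussℕ-vanish : ∀ {N M} → N < M → gaussℕ N M ≋ zeroPS
gaussℕ-vanish {N} {M} N<M rewrite dec-false (M ℕₚ.≤? N) (ℕₚ.<⇒≱ N<M) = ≋-refl

qPoch-inverse : ∀ N → qPoch N ⊛ invQPoch N ≋ one
qPoch-inverse zero    = ⊛-identityˡ one
qPoch-inverse (suc N) = begin
  qPoch N ⊛ oneMinusQ N ⊛ (invQPoch N ⊛ invOneMinusQ N)
    ≈⟨ solve 4 (λ a b c d → a :* b :* (c :* d) := a :* c :* (b :* d)) ≋-refl
         (qPoch N) (oneMinusQ N) (invQPoch N) (invOneMinusQ N) ⟩
  qPoch N ⊛ invQPoch N ⊛ (oneMinusQ N ⊛ invOneMinusQ N)
    ≈⟨ ⊛-cong (qPoch-inverse N) (invOneMinusQ-inverse N) ⟩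
  one ⊛ one
    ≈⟨ ⊛-identityˡ one ⟩
  one ∎
  where open ≋-Reasoning

gaussℕ-zero : ∀ N → gaussℕ N 0 ≋ one
gaussℕ-zero N = ≋-trans (gaussℕ-def 0 N refl)
  (≋-trans (⊛-congʳ (invQPoch N) (≋-trans (⊛-comm (qPoch N) one) (⊛-identityˡ (qPoch N)))) (qPoch-inverse N))

gaussℕ-diag : ∀ N → gaussℕ N N ≋ one
gaussℕ-diag N = ≋-trans (gaussℕ-def N 0 (ℕₚ.+-identityʳ N))
  (≋-trans (⊛-comm (qPoch N ⊛ invQPoch N) one) (≋-trans (⊛-identityˡ _) (qPoch-inverse N)))

-- Over the common denominator D = (q;q)_{l+r+1} / ((q;q)_{l+1} (q;q)_{r+1}) both Pascal rules
-- become polynomial identities in x = q^l, z = q^(r+1) and q.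
module _ (l r : ℕ) where
  private
    D = qPoch (suc (l + r)) ⊛ invQPoch (suc l) ⊛ invQPoch (suc r)
    q = mono 1
    x = mono l
    z = mono (suc r)

    outer : gaussℕ (suc (suc (l + r))) (suc l) ≋ D ⊛ (one ⊖ q ⊛ x ⊛ z)
    outer = ≋-trans (gaussℕ-def (suc l) (suc r) (cong suc (ℕₚ.+-suc l r)))
      (≋-trans (solve 4 (λ Q o a b → Q :* o :* a :* b := Q :* a :* b :* o) ≋-refl
                  (qPoch (suc (l + r))) (oneMinusQ (suc (l + r))) (invQPoch (suc l)) (invQPoch (suc r)))
        (⊛-congˡ D (⊖-congˡ one (≋-trans (mono-split (suc l) (suc r) (cong suc (ℕₚ.+-suc l r)))
                                         (⊛-congʳ z (mono-split 1 l refl))))))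

    upper : gaussℕ (suc (l + r)) (suc l) ≋ D ⊛ (one ⊖ z)
    upper = ≋-trans (gaussℕ-def (suc l) r refl)
      (≋-trans (⊛-congˡ (qPoch (suc (l + r)) ⊛ invQPoch (suc l)) (invQPoch-step r))
        (≋-sym (⊛-assoc (qPoch (suc (l + r)) ⊛ invQPoch (suc l)) (invQPoch (suc r)) (oneMinusQ r))))

    lower : gaussℕ (suc (l + r)) l ≋ D ⊛ (one ⊖ q ⊛ x)
    lower = ≋-trans (gaussℕ-def l (suc r) (ℕₚ.+-suc l r))
      (≋-trans (⊛-congʳ (invQPoch (suc r)) (⊛-congˡ (qPoch (suc (l + r))) (invQPoch-step l)))
        (≋-trans (solve 4 (λ Q a o b → Q :* (a :* o) :* b := Q :* a :* b :* o) ≋-refl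
                    (qPoch (suc (l + r))) (invQPoch (suc l)) (oneMinusQ l) (invQPoch (suc r)))
          (⊛-congˡ D (⊖-congˡ one (mono-split 1 l refl)))))

  gaussℕ-pascal₁-generic :
    x ⊛ gaussℕ (suc (suc (l + r))) (suc l) ≋
    x ⊛ gaussℕ (suc (l + r)) (suc l) ⊕ mono (suc (l + r)) ⊛ gaussℕ (suc (l + r)) l
  gaussℕ-pascal₁-generic = begin
    x ⊛ gaussℕ (suc (suc (l + r))) (suc l)   ≈⟨ ⊛-congˡ x outer ⟩
    x ⊛ (D ⊛ (one ⊖ q ⊛ x ⊛ z))              ≈⟨ solve 4 (λ x q z D → x :* (D :* (con (+ 1) :- q :* x :* z))
                                                          := x :* (D :* (con (+ 1) :- z)) :+ x :* z :* (D :* (con (+ 1) :- q :* x)))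
                                                     ≋-refl x q z D ⟩
    x ⊛ (D ⊛ (one ⊖ z)) ⊕ x ⊛ z ⊛ (D ⊛ (one ⊖ q ⊛ x))
      ≈⟨ ⊕-cong (⊛-congˡ x upper) (⊛-cong (mono-split l (suc r) (ℕₚ.+-suc l r)) lower) ⟨
    x ⊛ gaussℕ (suc (l + r)) (suc l) ⊕ mono (suc (l + r)) ⊛ gaussℕ (suc (l + r)) l ∎
    where open ≋-Reasoning

  gaussℕ-pascal₂-generic :
    gaussℕ (suc (suc (l + r))) (suc l) ≋
    mono (suc l) ⊛ gaussℕ (suc (l + r)) (suc l) ⊕ gaussℕ (suc (l + r)) l
  gaussℕ-pascal₂-generic = begin
    gaussℕ (suc (suc (l + r))) (suc l)       ≈⟨ outer ⟩
    D ⊛ (one ⊖ q ⊛ x ⊛ z)                    ≈⟨ solve 4 (λ x q z D → D :* (con (+ 1) :- q :* x :* z)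
                                                          := q :* x :* (D :* (con (+ 1) :- z)) :+ D :* (con (+ 1) :- q :* x))
                                                     ≋-refl x q z D ⟩
    q ⊛ x ⊛ (D ⊛ (one ⊖ z)) ⊕ D ⊛ (one ⊖ q ⊛ x)
      ≈⟨ ⊕-cong (⊛-cong (mono-split 1 l refl) upper) lower ⟨
    mono (suc l) ⊛ gaussℕ (suc (l + r)) (suc l) ⊕ gaussℕ (suc (l + r)) l ∎
    where open ≋-Reasoning

gaussℕ-pascal₁ : ∀ A n → mono n ⊛ gaussℕ (suc A) (suc n) ≋ mono n ⊛ gaussℕ A (suc n) ⊕ mono A ⊛ gaussℕ A n
gaussℕ-pascal₁ A n with ℕₚ.<-cmp n A
... | tri< n<A _ _ with ℕₚ.m≤n⇒∃[o]m+o≡n n<A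
...   | r , refl = gaussℕ-pascal₁-generic n r
gaussℕ-pascal₁ A n | tri≈ _ refl _ = begin
  mono n ⊛ gaussℕ (suc n) (suc n)                  ≈⟨ ⊛-congˡ (mono n) (gaussℕ-diag (suc n)) ⟩
  mono n ⊛ one                                     ≈⟨ ⊛-congˡ (mono n) (gaussℕ-diag n) ⟨
  mono n ⊛ gaussℕ n n                              ≈⟨ ⊕-identityˡ _ ⟨
  zeroPS ⊕ mono n ⊛ gaussℕ n n
    ≈⟨ ⊕-congʳ _ (⊛-vanishʳ (mono n) (gaussℕ-vanish (ℕₚ.n<1+n n))) ⟨
  mono n ⊛ gaussℕ n (suc n) ⊕ mono n ⊛ gaussℕ n n  ∎
  where open ≋-Reasoning
gaussℕ-pascal₁ A n | tri> _ _ A<n = begin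
  mono n ⊛ gaussℕ (suc A) (suc n)                  ≈⟨ ⊛-vanishʳ (mono n) (gaussℕ-vanish (s≤s A<n)) ⟩
  zeroPS                                           ≈⟨ ⊕-identityˡ zeroPS ⟨
  zeroPS ⊕ zeroPS
    ≈⟨ ⊕-cong (⊛-vanishʳ (mono n) (gaussℕ-vanish (ℕₚ.m<n⇒m<1+n A<n))) (⊛-vanishʳ (mono A) (gaussℕ-vanish A<n)) ⟨
  mono n ⊛ gaussℕ A (suc n) ⊕ mono A ⊛ gaussℕ A n  ∎
  where open ≋-Reasoning

gaussℕ-pascal₂ : ∀ n l → gaussℕ (suc n) (suc l) ≋ mono (suc l) ⊛ gaussℕ n (suc l) ⊕ gaussℕ n l
gaussℕ-pascal₂ n l with ℕₚ.<-cmp l n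
... | tri< l<n _ _ with ℕₚ.m≤n⇒∃[o]m+o≡n l<n
...   | r , refl = gaussℕ-pascal₂-generic l r
gaussℕ-pascal₂ n l | tri≈ _ refl _ = begin
  gaussℕ (suc l) (suc l)                        ≈⟨ gaussℕ-diag (suc l) ⟩
  one                                           ≈⟨ gaussℕ-diag l ⟨
  gaussℕ l l                                    ≈⟨ ⊕-identityˡ _ ⟨
  zeroPS ⊕ gaussℕ l l
    ≈⟨ ⊕-congʳ _ (⊛-vanishʳ (mono (suc l)) (gaussℕ-vanish (ℕₚ.n<1+n l))) ⟨
  mono (suc l) ⊛ gaussℕ l (suc l) ⊕ gaussℕ l l  ∎
  where open ≋-Reasoning
gaussℕ-pascal₂ n l | tri> _ _ n<l = begin
  gaussℕ (suc n) (suc l)                        ≈⟨ gaussℕ-vanish (s≤s n<l) ⟩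
  zeroPS                                        ≈⟨ ⊕-identityˡ zeroPS ⟨
  zeroPS ⊕ zeroPS
    ≈⟨ ⊕-cong (⊛-vanishʳ (mono (suc l)) (gaussℕ-vanish (ℕₚ.m<n⇒m<1+n n<l))) (gaussℕ-vanish n<l) ⟨
  mono (suc l) ⊛ gaussℕ n (suc l) ⊕ gaussℕ n l  ∎
  where open ≋-Reasoning

-- The series a_m and b_m

tri : ℕ → ℕ
tri zero    = zero
tri (suc n) = tri n + n

-- The sum over l in a_K, and in b_{K+1}.
innerSum : ℕ → ℕ → PS
innerSum K n = sumPS K (λ l → mono (tri (suc l)) ⊛ gaussℕ (K ∸ 1 ∸ l) n ⊛ gaussℕ n l)

innerSum-at-zero : ∀ K → innerSum (suc K) 0 ≋ one
innerSum-at-zero K = begin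
  innerSum (suc K) 0
    ≈⟨ sumPS-head K _ ⟩
  mono 0 ⊛ gaussℕ K 0 ⊛ gaussℕ 0 0 ⊕ sumPS K (λ l → M l ⊛ gaussℕ 0 (suc l))
    ≈⟨ ⊕-cong leading (sumPS-zero K (λ l _ → ⊛-vanishʳ (M l) (gaussℕ-vanish {0} {suc l} (s≤s z≤n)))) ⟩
  one ⊕ zeroPS
    ≈⟨ ⊕-identityʳ one ⟩
  one ∎
  where
  open ≋-Reasoning
  M : ℕ → PS
  M l = mono (tri (suc (suc l))) ⊛ gaussℕ (K ∸ suc l) 0
  leading : mono 0 ⊛ gaussℕ K 0 ⊛ gaussℕ 0 0 ≋ one
  leading = ≋-trans (⊛-cong (⊛-cong mono-zero (gaussℕ-zero K)) (gaussℕ-zero 0))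
                    (≋-trans (⊛-congʳ one (⊛-identityˡ one)) (⊛-identityˡ one))

innerSum-vanish : ∀ {K} n → K ≤ n → innerSum K n ≋ zeroPS
innerSum-vanish {zero}  n K≤n = ≋-refl
innerSum-vanish {suc K} n K≤n = sumPS-zero (suc K) (λ l _ → ⊛-vanishˡ (gaussℕ n l)
  (⊛-vanishʳ (mono (tri (suc l))) (gaussℕ-vanish (ℕₚ.<-≤-trans (s≤s (ℕₚ.m∸n≤m K l)) K≤n))))

innerSum-drop-top : ∀ K n → innerSum (suc (suc K)) (suc n) ≋
  sumPS (suc K) (λ l → mono (tri (suc l)) ⊛ gaussℕ (suc (K ∸ l)) (suc n) ⊛ gaussℕ (suc n) l)
innerSum-drop-top K n = ≋-trans (sumPS-extend term (ℕₚ.n≤1+n (suc K)) top-vanishes) (sumPS-cong (suc K) reindex)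
  where
  term : ℕ → PS
  term l = mono (tri (suc l)) ⊛ gaussℕ (suc K ∸ l) (suc n) ⊛ gaussℕ (suc n) l
  top-vanishes : ∀ l → suc K ≤ l → l < suc (suc K) → term l ≋ zeroPS
  top-vanishes l 1+K≤l _ rewrite ℕₚ.m≤n⇒m∸n≡0 1+K≤l =
    ⊛-vanishˡ (gaussℕ (suc n) l) (⊛-vanishʳ (mono (tri (suc l))) (gaussℕ-vanish {0} {suc n} (s≤s z≤n)))
  reindex : ∀ l → l < suc K → term l ≋ mono (tri (suc l)) ⊛ gaussℕ (suc (K ∸ l)) (suc n) ⊛ gaussℕ (suc n) l
  reindex l l≤K rewrite ℕₚ.+-∸-assoc 1 (ℕₚ.≤-pred l≤K) = ≋-refl

innerSum-shifted : ∀ K n →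
  sumPS (suc K) (λ l → mono (tri (suc l)) ⊛ (mono (K ∸ l) ⊛ gaussℕ (K ∸ l) n) ⊛ gaussℕ (suc n) l)
    ≋ mono K ⊛ (innerSum (suc K) n ⊕ innerSum K n)
innerSum-shifted K n = begin
  sumPS (suc K) (λ l → M l ⊛ (mono (K ∸ l) ⊛ gaussℕ (K ∸ l) n) ⊛ gaussℕ (suc n) l)
    ≈⟨ sumPS-head K _ ⟩
  M 0 ⊛ (mono K ⊛ gaussℕ K n) ⊛ gaussℕ (suc n) 0 ⊕
    sumPS K (λ l → M (suc l) ⊛ (mono (K ∸ suc l) ⊛ gaussℕ (K ∸ suc l) n) ⊛ gaussℕ (suc n) (suc l))
    ≈⟨ ⊕-cong leading (sumPS-cong K split) ⟩
  mono K ⊛ t₀ ⊕ sumPS K (λ l → mono K ⊛ t₁ l ⊕ mono K ⊛ t₂ l)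
    ≈⟨ ⊕-congˡ (mono K ⊛ t₀) (sumPS-distrib-⊕ K _ _) ⟩
  mono K ⊛ t₀ ⊕ (sumPS K (λ l → mono K ⊛ t₁ l) ⊕ sumPS K (λ l → mono K ⊛ t₂ l))
    ≈⟨ ⊕-congˡ (mono K ⊛ t₀) (⊕-cong (⊛-distribˡ-sumPS K (mono K) t₁) (⊛-distribˡ-sumPS K (mono K) t₂)) ⟨
  mono K ⊛ t₀ ⊕ (mono K ⊛ sumPS K t₁ ⊕ mono K ⊛ sumPS K t₂)
    ≈⟨ solve 4 (λ x a b c → x :* a :+ (x :* b :+ x :* c) := x :* (a :+ b :+ c))
         ≋-refl (mono K) t₀ (sumPS K t₁) (sumPS K t₂) ⟩
  mono K ⊛ (t₀ ⊕ sumPS K t₁ ⊕ sumPS K t₂)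
    ≈⟨ ⊛-congˡ (mono K) (⊕-cong (sumPS-head K (λ l → M l ⊛ gaussℕ (K ∸ l) n ⊛ gaussℕ n l))
                                (sumPS-cong K (λ l _ → reindex l))) ⟨
  mono K ⊛ (innerSum (suc K) n ⊕ innerSum K n)
    ∎
  where
  open ≋-Reasoning
  M : ℕ → PS
  M l = mono (tri (suc l))
  t₀ = M 0 ⊛ gaussℕ K n ⊛ gaussℕ n 0
  t₁ t₂ : ℕ → PS
  t₁ l = M (suc l) ⊛ gaussℕ (K ∸ suc l) n ⊛ gaussℕ n (suc l)
  t₂ l = M l ⊛ gaussℕ (K ∸ suc l) n ⊛ gaussℕ n l
  reindex : ∀ l → M l ⊛ gaussℕ (K ∸ 1 ∸ l) n ⊛ gaussℕ n l ≋ t₂ l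
  reindex l rewrite ℕₚ.∸-+-assoc K 1 l = ≋-refl
  leading : M 0 ⊛ (mono K ⊛ gaussℕ K n) ⊛ gaussℕ (suc n) 0 ≋ mono K ⊛ t₀
  leading = ≋-trans (⊛-congˡ (M 0 ⊛ (mono K ⊛ gaussℕ K n))
                             (≋-trans (gaussℕ-zero (suc n)) (≋-sym (gaussℕ-zero n))))
    (solve 4 (λ m x a b → m :* (x :* a) :* b := x :* (m :* a :* b)) ≋-refl (M 0) (mono K) (gaussℕ K n) (gaussℕ n 0))
  split : ∀ l → l < K → M (suc l) ⊛ (mono (K ∸ suc l) ⊛ gaussℕ (K ∸ suc l) n) ⊛ gaussℕ (suc n) (suc l) ≋
                        mono K ⊛ t₁ l ⊕ mono K ⊛ t₂ l
  split l l<K = begin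
    M (suc l) ⊛ (y ⊛ g) ⊛ gaussℕ (suc n) (suc l)
      ≈⟨ ⊛-congˡ (M (suc l) ⊛ (y ⊛ g)) (gaussℕ-pascal₂ n l) ⟩
    M (suc l) ⊛ (y ⊛ g) ⊛ (mono (suc l) ⊛ gaussℕ n (suc l) ⊕ gaussℕ n l)
      ≈⟨ solve 6 (λ m y g z a b → m :* (y :* g) :* (z :* a :+ b) := y :* z :* (m :* g :* a) :+ m :* y :* (g :* b))
           ≋-refl (M (suc l)) y g (mono (suc l)) (gaussℕ n (suc l)) (gaussℕ n l) ⟩
    y ⊛ mono (suc l) ⊛ t₁ l ⊕ M (suc l) ⊛ y ⊛ (g ⊛ gaussℕ n l)
      ≈⟨ ⊕-cong (⊛-congʳ (t₁ l) (≋-trans (mono-+ _ (suc l)) (mono-cong (ℕₚ.m∸n+n≡m l<K))))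
                (⊛-congʳ (g ⊛ gaussℕ n l) (mono-⊛-regroup _ _ K _ exponent)) ⟩
    mono K ⊛ t₁ l ⊕ mono K ⊛ M l ⊛ (g ⊛ gaussℕ n l)
      ≈⟨ ⊕-congˡ (mono K ⊛ t₁ l)
                (solve 4 (λ x m g b → x :* m :* (g :* b) := x :* (m :* g :* b)) ≋-refl (mono K) (M l) g (gaussℕ n l)) ⟩
    mono K ⊛ t₁ l ⊕ mono K ⊛ t₂ l
      ∎
    where
    y = mono (K ∸ suc l)
    g = gaussℕ (K ∸ suc l) n
    exponent : tri (suc l) + suc l + (K ∸ suc l) ≡ K + tri (suc l)
    exponent = trans (ℕₚ.+-assoc (tri (suc l)) (suc l) _)
                      (trans (cong (λ e → tri (suc l) + e) (ℕₚ.m+[n∸m]≡n l<K)) (ℕₚ.+-comm (tri (suc l)) K))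

innerSum-step : ∀ K n → mono n ⊛ innerSum (suc (suc K)) (suc n) ≋
  mono n ⊛ innerSum (suc K) (suc n) ⊕ mono K ⊛ (innerSum (suc K) n ⊕ innerSum K n)
innerSum-step K n = begin
  x ⊛ innerSum (suc (suc K)) (suc n)
    ≈⟨ ⊛-congˡ x (innerSum-drop-top K n) ⟩
  x ⊛ sumPS (suc K) (λ l → M l ⊛ gaussℕ (suc (K ∸ l)) (suc n) ⊛ G l)
    ≈⟨ ⊛-distribˡ-sumPS (suc K) x (λ l → M l ⊛ gaussℕ (suc (K ∸ l)) (suc n) ⊛ G l) ⟩
  sumPS (suc K) (λ l → x ⊛ (M l ⊛ gaussℕ (suc (K ∸ l)) (suc n) ⊛ G l))
    ≈⟨ sumPS-cong (suc K) (λ l _ → pascal l) ⟩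
  sumPS (suc K) (λ l → x ⊛ t l ⊕ s l)
    ≈⟨ sumPS-distrib-⊕ (suc K) _ s ⟩
  sumPS (suc K) (λ l → x ⊛ t l) ⊕ sumPS (suc K) s
    ≈⟨ ⊕-cong (⊛-distribˡ-sumPS (suc K) x t) (≋-sym (innerSum-shifted K n)) ⟨
  x ⊛ innerSum (suc K) (suc n) ⊕ mono K ⊛ (innerSum (suc K) n ⊕ innerSum K n)
    ∎
  where
  open ≋-Reasoning
  x = mono n
  M G t s : ℕ → PS
  M l = mono (tri (suc l))
  G l = gaussℕ (suc n) l
  t l = M l ⊛ gaussℕ (K ∸ l) (suc n) ⊛ G l
  s l = M l ⊛ (mono (K ∸ l) ⊛ gaussℕ (K ∸ l) n) ⊛ G l
  pascal : ∀ l → x ⊛ (M l ⊛ gaussℕ (suc (K ∸ l)) (suc n) ⊛ G l) ≋ x ⊛ t l ⊕ s l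
  pascal l = begin
    x ⊛ (M l ⊛ gaussℕ (suc (K ∸ l)) (suc n) ⊛ G l)
      ≈⟨ solve 4 (λ x m a G → x :* (m :* a :* G) := m :* (x :* a) :* G)
           ≋-refl x (M l) (gaussℕ (suc (K ∸ l)) (suc n)) (G l) ⟩
    M l ⊛ (x ⊛ gaussℕ (suc (K ∸ l)) (suc n)) ⊛ G l
      ≈⟨ ⊛-congʳ (G l) (⊛-congˡ (M l) (gaussℕ-pascal₁ (K ∸ l) n)) ⟩
    M l ⊛ (x ⊛ gaussℕ (K ∸ l) (suc n) ⊕ mono (K ∸ l) ⊛ gaussℕ (K ∸ l) n) ⊛ G l
      ≈⟨ solve 5 (λ x m a b G → m :* (x :* a :+ b) :* G := x :* (m :* a :* G) :+ m :* b :* G)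
           ≋-refl x (M l) (gaussℕ (K ∸ l) (suc n)) (mono (K ∸ l) ⊛ gaussℕ (K ∸ l) n) (G l) ⟩
    x ⊛ t l ⊕ s l
      ∎

abTerm : ℕ → ℕ → ℕ → PS
abTerm c K n = mono (tri n + c * n) ⊛ innerSum K n

-- abSeries 0 (K + 1) = a_{K+1} and abSeries 1 K = b_{K+1}
abSeries : ℕ → ℕ → PS
abSeries c K = sumPS K (abTerm c K)

abTerm-at-zero : ∀ c K → abTerm c (suc K) 0 ≋ one
abTerm-at-zero c K =
  ≋-trans (⊛-cong (≋-trans (mono-cong (ℕₚ.*-zeroʳ c)) mono-zero) (innerSum-at-zero K)) (⊛-identityˡ one)

abTerm-vanish : ∀ c {K} n → K ≤ n → abTerm c K n ≋ zeroPS
abTerm-vanish c n K≤n = ⊛-vanishʳ (mono (tri n + c * n)) (innerSum-vanish n K≤n)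

abTerm-step : ∀ c K n →
  abTerm c (suc (suc K)) (suc n) ≋ abTerm c (suc K) (suc n) ⊕ mono (K + c) ⊛ (abTerm c (suc K) n ⊕ abTerm c K n)
abTerm-step c K n = begin
  mono (tri (suc n) + c * suc n) ⊛ innerSum (suc (suc K)) (suc n)
    ≈⟨ ⊛-congʳ (innerSum (suc (suc K)) (suc n)) (mono-split e n (arithmetic (tri n) n c)) ⟩
  mono e ⊛ mono n ⊛ innerSum (suc (suc K)) (suc n)
    ≈⟨ ⊛-assoc (mono e) (mono n) (innerSum (suc (suc K)) (suc n)) ⟩
  mono e ⊛ (mono n ⊛ innerSum (suc (suc K)) (suc n))
    ≈⟨ ⊛-congˡ (mono e) (innerSum-step K n) ⟩
  mono e ⊛ (mono n ⊛ innerSum (suc K) (suc n) ⊕ mono K ⊛ (innerSum (suc K) n ⊕ innerSum K n))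
    ≈⟨ solve 6 (λ y x z a b d → y :* (x :* a :+ z :* (b :+ d)) := y :* x :* a :+ z :* y :* (b :+ d))
         ≋-refl (mono e) (mono n) (mono K) (innerSum (suc K) (suc n)) (innerSum (suc K) n) (innerSum K n) ⟩
  mono e ⊛ mono n ⊛ innerSum (suc K) (suc n) ⊕ mono K ⊛ mono e ⊛ (innerSum (suc K) n ⊕ innerSum K n)
    ≈⟨ ⊕-cong (⊛-congʳ (innerSum (suc K) (suc n)) (mono-split e n (arithmetic (tri n) n c)))
              (⊛-congʳ (innerSum (suc K) n ⊕ innerSum K n)
                       (mono-⊛-regroup (K + c) (tri n + c * n) K e (arithmetic′ K (tri n) n c))) ⟨
  abTerm c (suc K) (suc n) ⊕ mono (K + c) ⊛ mono (tri n + c * n) ⊛ (innerSum (suc K) n ⊕ innerSum K n)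
    ≈⟨ ⊕-congˡ (abTerm c (suc K) (suc n))
         (≋-trans (⊛-assoc (mono (K + c)) (mono (tri n + c * n)) (innerSum (suc K) n ⊕ innerSum K n))
                  (⊛-congˡ (mono (K + c)) (⊛-distribˡ-⊕ (mono (tri n + c * n)) (innerSum (suc K) n) (innerSum K n)))) ⟩
  abTerm c (suc K) (suc n) ⊕ mono (K + c) ⊛ (abTerm c (suc K) n ⊕ abTerm c K n)
    ∎
  where
  open ≋-Reasoning
  e = tri n + c * n + c
  arithmetic : ∀ t n c → t + c * n + c + n ≡ t + n + c * suc n
  arithmetic = solve-∀
  arithmetic′ : ∀ K t n c → K + c + (t + c * n) ≡ K + (t + c * n + c)
  arithmetic′ = solve-∀

abSeries-recurrence : ∀ c K →
  abSeries c (suc (suc K)) ≋ (one ⊕ mono (K + c)) ⊛ abSeries c (suc K) ⊕ mono (K + c) ⊛ abSeries c K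
abSeries-recurrence c K = begin
  sumPS (suc (suc K)) t₂
    ≈⟨ sumPS-head (suc K) t₂ ⟩
  t₂ 0 ⊕ sumPS (suc K) (t₂ ∘ suc)
    ≈⟨ ⊕-cong (≋-trans (abTerm-at-zero c (suc K)) (≋-sym (abTerm-at-zero c K)))
              (sumPS-cong (suc K) (λ n _ → abTerm-step c K n)) ⟩
  t₁ 0 ⊕ sumPS (suc K) (λ n → t₁ (suc n) ⊕ y ⊛ (t₁ n ⊕ t₀ n))
    ≈⟨ ⊕-congˡ (t₁ 0) (sumPS-distrib-⊕ (suc K) (t₁ ∘ suc) (λ n → y ⊛ (t₁ n ⊕ t₀ n))) ⟩
  t₁ 0 ⊕ (sumPS (suc K) (t₁ ∘ suc) ⊕ sumPS (suc K) (λ n → y ⊛ (t₁ n ⊕ t₀ n)))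
    ≈⟨ ⊕-assoc (t₁ 0) (sumPS (suc K) (t₁ ∘ suc)) _ ⟨
  t₁ 0 ⊕ sumPS (suc K) (t₁ ∘ suc) ⊕ sumPS (suc K) (λ n → y ⊛ (t₁ n ⊕ t₀ n))
    ≈⟨ ⊕-cong (sumPS-head (suc K) t₁)
              (≋-trans (⊛-congˡ y (≋-sym (sumPS-distrib-⊕ (suc K) t₁ t₀)))
                       (⊛-distribˡ-sumPS (suc K) y (λ n → t₁ n ⊕ t₀ n))) ⟨
  sumPS (suc (suc K)) t₁ ⊕ y ⊛ (sumPS (suc K) t₁ ⊕ sumPS (suc K) t₀)
    ≈⟨ ⊕-cong (drop-last (suc K)) (⊛-congˡ y (⊕-congˡ (sumPS (suc K) t₁) (drop-last K))) ⟩
  abSeries c (suc K) ⊕ y ⊛ (abSeries c (suc K) ⊕ abSeries c K)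
    ≈⟨ solve 3 (λ a y b → a :+ y :* (a :+ b) := (con (+ 1) :+ y) :* a :+ y :* b)
         ≋-refl (abSeries c (suc K)) y (abSeries c K) ⟩
  (one ⊕ y) ⊛ abSeries c (suc K) ⊕ y ⊛ abSeries c K
    ∎
  where
  open ≋-Reasoning
  y = mono (K + c)
  t₀ t₁ t₂ : ℕ → PS
  t₀ = abTerm c K
  t₁ = abTerm c (suc K)
  t₂ = abTerm c (suc (suc K))
  drop-last : ∀ K′ → sumPS (suc K′) (abTerm c K′) ≋ abSeries c K′
  drop-last K′ = sumPS-extend (abTerm c K′) (ℕₚ.n≤1+n K′) (λ n K′≤n _ → abTerm-vanish c n K′≤n)

[m-n]-o≡m⊖[n+o] : ∀ a b l → + a ℤ.- + b ℤ.- + l ≡ a ℤ.⊖ (b + l)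
[m-n]-o≡m⊖[n+o] a b l = trans (ℤₚ.+-assoc (+ a) (ℤ.- + b) (ℤ.- + l))
  (trans (cong (λ z → + a ℤ.+ z) (sym (ℤₚ.neg-distrib-+ (+ b) (+ l)))) (ℤₚ.m-n≡m⊖n a (b + l)))

gauss-sub : ∀ a b l n → b + l ≤ a → gauss (+ a ℤ.- + b ℤ.- + l) (+ n) ≋ gaussℕ (a ∸ (b + l)) n
gauss-sub a b l n b+l≤a rewrite [m-n]-o≡m⊖[n+o] a b l | ℤₚ.⊖-≥ b+l≤a = ≋-refl

gauss-sub-negative : ∀ a b l n → a < b + l → gauss (+ a ℤ.- + b ℤ.- + l) (+ n) ≋ zeroPS
gauss-sub-negative a b l n a<b+l with ℕₚ.m≤n⇒∃[o]m+o≡n a<b+l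
... | o , 1+a+o≡b+l rewrite [m-n]-o≡m⊖[n+o] a b l | ℤₚ.⊖-< a<b+l | sym 1+a+o≡b+l
                          | sym (ℕₚ.+-suc a o) | ℕₚ.m+n∸m≡n a (suc o) = ≋-refl

tri-double : ∀ n → tri (suc n) * 2 ≡ suc n * n
tri-double zero    = refl
tri-double (suc n) = trans (ℕₚ.*-distribʳ-+ 2 (tri (suc n)) (suc n))
                           (trans (cong (_+ suc n * 2) (tri-double n)) (arithmetic n))
  where
  arithmetic : ∀ n → suc n * n + suc n * 2 ≡ suc (suc n) * suc n
  arithmetic = solve-∀

tri-≡tri : ∀ n → tri- n ≡ tri n
tri-≡tri zero    = refl
tri-≡tri (suc n) = trans (cong (_/ 2) (sym (tri-double n))) (m*n/n≡m (tri (suc n)) 2)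

tri+≡tri∘suc : ∀ n → tri+ n ≡ tri (suc n)
tri+≡tri∘suc n = trans (cong (_/ 2) (ℕₚ.*-comm n (suc n))) (tri-≡tri (suc n))

-- The double sums defining a_{K′} (b′ = 0) and b_{K′+1} (b′ = 1), with m = b′ + K′.
doubleSum≋abSeries : ∀ c b′ K′ (E : ℕ → ℕ → ℕ) → (∀ n l → E n l ≡ tri n + c * n + tri (suc l)) →
  sumPS (suc (b′ + K′)) (λ n → sumPS (suc (b′ + K′)) (λ l →
    mono (E n l) ⊛ gauss (+ (b′ + K′) ℤ.- + suc b′ ℤ.- + l) (+ n) ⊛ gauss (+ n) (+ l)))
  ≋ abSeries c K′
doubleSum≋abSeries c b′ K′ E E≡ = ≋-trans (sumPS-cong (suc m) (λ n _ → inner n))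
  (sumPS-extend (abTerm c K′) K′≤range (λ n K′≤n _ → abTerm-vanish c n K′≤n))
  where
  open ≋-Reasoning
  m = b′ + K′
  K′≤range : K′ ≤ suc m
  K′≤range = ℕₚ.m≤n⇒m≤1+n (ℕₚ.m≤n+m K′ b′)
  T : ℕ → ℕ → PS
  T n l = mono (E n l) ⊛ gauss (+ m ℤ.- + suc b′ ℤ.- + l) (+ n) ⊛ gauss (+ n) (+ l)
  term : ∀ n l → l < K′ →
         T n l ≋ mono (tri n + c * n) ⊛ (mono (tri (suc l)) ⊛ gaussℕ (K′ ∸ 1 ∸ l) n ⊛ gaussℕ n l)
  term n l l<K′ = begin
    T n l
      ≈⟨ ⊛-congʳ (gaussℕ n l) (⊛-cong (mono-split _ _ (sym (E≡ n l))) (gauss-sub m (suc b′) l n in-range)) ⟩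
    mono (tri n + c * n) ⊛ mono (tri (suc l)) ⊛ gaussℕ (m ∸ (suc b′ + l)) n ⊛ gaussℕ n l
      ≈⟨ ⊛-congʳ (gaussℕ n l) (⊛-congˡ (mono (tri n + c * n) ⊛ mono (tri (suc l)))
                                       (≋-reflexive (cong (λ N → gaussℕ N n) index))) ⟩
    mono (tri n + c * n) ⊛ mono (tri (suc l)) ⊛ gaussℕ (K′ ∸ 1 ∸ l) n ⊛ gaussℕ n l
      ≈⟨ ⊛-assoc₃ (mono (tri n + c * n)) (mono (tri (suc l))) (gaussℕ (K′ ∸ 1 ∸ l) n) (gaussℕ n l) ⟩
    mono (tri n + c * n) ⊛ (mono (tri (suc l)) ⊛ gaussℕ (K′ ∸ 1 ∸ l) n ⊛ gaussℕ n l)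
      ∎
    where
    in-range : suc b′ + l ≤ m
    in-range = subst (_≤ m) (ℕₚ.+-suc b′ l) (ℕₚ.+-monoʳ-≤ b′ l<K′)
    index : m ∸ (suc b′ + l) ≡ K′ ∸ 1 ∸ l
    index = trans (cong (m ∸_) (sym (ℕₚ.+-suc b′ l)))
                  (trans (ℕₚ.[m+n]∸[m+o]≡n∸o b′ K′ (suc l)) (sym (ℕₚ.∸-+-assoc K′ 1 l)))
  out-of-range : ∀ n l → K′ ≤ l → T n l ≋ zeroPS
  out-of-range n l K′≤l = ⊛-vanishˡ (gaussℕ n l) (⊛-vanishʳ (mono (E n l))
    (gauss-sub-negative m (suc b′) l n (s≤s (ℕₚ.+-monoʳ-≤ b′ K′≤l))))
  inner : ∀ n → sumPS (suc m) (T n) ≋ abTerm c K′ n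
  inner n = begin
    sumPS (suc m) (T n)
      ≈⟨ sumPS-extend (T n) K′≤range (λ l K′≤l _ → out-of-range n l K′≤l) ⟩
    sumPS K′ (T n)
      ≈⟨ sumPS-cong K′ (term n) ⟩
    sumPS K′ (λ l → mono (tri n + c * n) ⊛ (mono (tri (suc l)) ⊛ gaussℕ (K′ ∸ 1 ∸ l) n ⊛ gaussℕ n l))
      ≈⟨ ⊛-distribˡ-sumPS K′ (mono (tri n + c * n))
                            (λ l → mono (tri (suc l)) ⊛ gaussℕ (K′ ∸ 1 ∸ l) n ⊛ gaussℕ n l) ⟨
    abTerm c K′ n
      ∎

aSeries≋abSeries : ∀ m → aSeries m ≋ abSeries 0 m
aSeries≋abSeries zero    = ≋-refl
aSeries≋abSeries (suc K) = doubleSum≋abSeries 0 0 (suc K) (λ n l → tri- n + tri+ l)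
  (λ n l → cong₂ _+_ (trans (tri-≡tri n) (sym (ℕₚ.+-identityʳ (tri n)))) (tri+≡tri∘suc l))

bSeries≋abSeries : ∀ K → bSeries (suc K) ≋ abSeries 1 K
bSeries≋abSeries K = doubleSum≋abSeries 1 1 K (λ n l → tri+ n + tri+ l)
  (λ n l → cong₂ _+_ (trans (tri+≡tri∘suc n) (cong (λ e → tri n + e) (sym (ℕₚ.*-identityˡ n))))
                     (tri+≡tri∘suc l))

-- The recurrences

recurrence-unique : ∀ (α β : ℕ → PS) {X Y : ℕ → PS} →
  (∀ m → X (suc (suc m)) ≋ α m ⊛ X m ⊖ β m ⊛ X (suc m)) →
  (∀ m → Y (suc (suc m)) ≋ α m ⊛ Y m ⊖ β m ⊛ Y (suc m)) →
  X 0 ≋ Y 0 → X 1 ≋ Y 1 → ∀ m → X m ≋ Y m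
recurrence-unique α β {X} {Y} recX recY X₀≋Y₀ X₁≋Y₁ m = proj₁ (consecutive m)
  where
  consecutive : ∀ m → X m ≋ Y m × X (suc m) ≋ Y (suc m)
  consecutive zero    = X₀≋Y₀ , X₁≋Y₁
  consecutive (suc m) with consecutive m
  ... | Xₘ≋Yₘ , Xₘ₊₁≋Yₘ₊₁ = Xₘ₊₁≋Yₘ₊₁ ,
    ≋-trans (recX m) (≋-trans (⊖-cong (⊛-congˡ (α m) Xₘ≋Yₘ) (⊛-congˡ (β m) Xₘ₊₁≋Yₘ₊₁))
                              (≋-sym (recY m)))

aSeries-recurrence : ∀ m → aSeries (suc (suc m)) ≋ (one ⊕ mono m) ⊛ aSeries (suc m) ⊕ mono m ⊛ aSeries m
aSeries-recurrence m = begin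
  aSeries (suc (suc m))
    ≈⟨ aSeries≋abSeries (suc (suc m)) ⟩
  abSeries 0 (suc (suc m))
    ≈⟨ abSeries-recurrence 0 m ⟩
  (one ⊕ mono (m + 0)) ⊛ abSeries 0 (suc m) ⊕ mono (m + 0) ⊛ abSeries 0 m
    ≈⟨ ⊕-cong (⊛-cong (⊕-congˡ one (mono-cong m≡m+0)) (aSeries≋abSeries (suc m)))
              (⊛-cong (mono-cong m≡m+0) (aSeries≋abSeries m)) ⟨
  (one ⊕ mono m) ⊛ aSeries (suc m) ⊕ mono m ⊛ aSeries m
    ∎
  where
  open ≋-Reasoning
  m≡m+0 = sym (ℕₚ.+-identityʳ m)

bSeries-recurrence : ∀ m → bSeries (suc (suc m)) ≋ (one ⊕ mono m) ⊛ bSeries (suc m) ⊕ mono m ⊛ bSeries m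
bSeries-recurrence zero = begin
  bSeries 2                                           ≈⟨ bSeries≋abSeries 1 ⟩
  abSeries 1 1                                        ≈⟨ ⊕-identityˡ (abTerm 1 1 0) ⟩
  abTerm 1 1 0                                        ≈⟨ abTerm-at-zero 1 0 ⟩
  one                                                 ≈⟨ ⊕-identityˡ one ⟨
  zeroPS ⊕ one                                        ≈⟨ ⊕-cong (⊛-vanishʳ (one ⊕ mono 0) (bSeries≋abSeries 0))
                                                                (≋-trans (⊛-congʳ one mono-zero) (⊛-identityˡ one)) ⟨
  (one ⊕ mono 0) ⊛ bSeries 1 ⊕ mono 0 ⊛ bSeries 0     ∎
  where open ≋-Reasoning
bSeries-recurrence (suc m) = begin
  bSeries (suc (suc (suc m)))
    ≈⟨ bSeries≋abSeries (suc (suc m)) ⟩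
  abSeries 1 (suc (suc m))
    ≈⟨ abSeries-recurrence 1 m ⟩
  (one ⊕ mono (m + 1)) ⊛ abSeries 1 (suc m) ⊕ mono (m + 1) ⊛ abSeries 1 m
    ≈⟨ ⊕-cong (⊛-cong (⊕-congˡ one (mono-cong 1+m≡m+1)) (bSeries≋abSeries (suc m)))
              (⊛-cong (mono-cong 1+m≡m+1) (bSeries≋abSeries m)) ⟨
  (one ⊕ mono (suc m)) ⊛ bSeries (suc (suc m)) ⊕ mono (suc m) ⊛ bSeries (suc m)
    ∎
  where
  open ≋-Reasoning
  1+m≡m+1 = ℕₚ.+-comm 1 m

rhsBracket : ℕ → PS
rhsBracket m = (aSeries m ⊖ bSeries m) ⊛ negQ2Q2 ⊖ bSeries m ⊛ negQQ2

rhsBracket-recurrence : ∀ m →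
  rhsBracket (suc (suc m)) ≋ (one ⊕ mono m) ⊛ rhsBracket (suc m) ⊕ mono m ⊛ rhsBracket m
rhsBracket-recurrence m = begin
  rhsBracket (suc (suc m))
    ≈⟨ ⊖-cong (⊛-congʳ negQ2Q2 (⊖-cong (aSeries-recurrence m) (bSeries-recurrence m)))
              (⊛-congʳ negQQ2 (bSeries-recurrence m)) ⟩
  ((one ⊕ x) ⊛ a₁ ⊕ x ⊛ a₀ ⊖ ((one ⊕ x) ⊛ b₁ ⊕ x ⊛ b₀)) ⊛ negQ2Q2
    ⊖ ((one ⊕ x) ⊛ b₁ ⊕ x ⊛ b₀) ⊛ negQQ2
    ≈⟨ solve 7 (λ x a₁ a₀ b₁ b₀ P Q →
         ((con (+ 1) :+ x) :* a₁ :+ x :* a₀ :- ((con (+ 1) :+ x) :* b₁ :+ x :* b₀)) :* P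
           :- ((con (+ 1) :+ x) :* b₁ :+ x :* b₀) :* Q
         := (con (+ 1) :+ x) :* ((a₁ :- b₁) :* P :- b₁ :* Q) :+ x :* ((a₀ :- b₀) :* P :- b₀ :* Q))
         ≋-refl x a₁ a₀ b₁ b₀ negQ2Q2 negQQ2 ⟩
  (one ⊕ x) ⊛ rhsBracket (suc m) ⊕ x ⊛ rhsBracket m
    ∎
  where
  open ≋-Reasoning
  x = mono m
  a₁ = aSeries (suc m)
  a₀ = aSeries m
  b₁ = bSeries (suc m)
  b₀ = bSeries m

signPred-suc : ∀ m → signPred (suc m) ≡ ℤ.- signPred m
signPred-suc zero          = refl
signPred-suc (suc zero)    = refl
signPred-suc (suc (suc m)) = signPred-suc m

scaledLhs : ℕ → PS
scaledLhs m = mono (tri m) ⊛ lhs m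

signedRhs : ℕ → PS
signedRhs m = scale (signPred m) (rhsBracket m)

scaledLhs-recurrence : ∀ m →
  scaledLhs (suc (suc m)) ≋ mono m ⊛ scaledLhs m ⊖ (one ⊕ mono m) ⊛ scaledLhs (suc m)
scaledLhs-recurrence m = begin
  T₂                      ≈⟨ solve 2 (λ a b → b := a :+ b :- a) ≋-refl ((one ⊕ x) ⊛ T₁) T₂ ⟩
  (one ⊕ x) ⊛ T₁ ⊕ T₂ ⊖ (one ⊕ x) ⊛ T₁ ≈⟨ ⊖-congʳ ((one ⊕ x) ⊛ T₁) shifted ⟨
  x ⊛ scaledLhs m ⊖ (one ⊕ x) ⊛ T₁     ∎
  where
  open ≋-Reasoning
  x = mono m
  T₁ = scaledLhs (suc m)
  T₂ = scaledLhs (suc (suc m))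
  shifted : x ⊛ scaledLhs m ≋ (one ⊕ x) ⊛ T₁ ⊕ T₂
  shifted = begin
    x ⊛ (mono (tri m) ⊛ lhs m)
      ≈⟨ solve 3 (λ x t F → x :* (t :* F) := t :* x :* F) ≋-refl x (mono (tri m)) (lhs m) ⟩
    mono (tri m) ⊛ x ⊛ lhs m
      ≈⟨ ⊛-cong (mono-+ (tri m) m) (lhs-recurrence m) ⟩
    mono (tri (suc m)) ⊛ ((one ⊕ x) ⊛ lhs (suc m) ⊕ mono (suc m) ⊛ lhs (suc (suc m)))
      ≈⟨ solve 5 (λ t x y F₁ F₂ → t :* ((con (+ 1) :+ x) :* F₁ :+ y :* F₂)
                                   := (con (+ 1) :+ x) :* (t :* F₁) :+ t :* y :* F₂)
           ≋-refl (mono (tri (suc m))) x (mono (suc m)) (lhs (suc m)) (lhs (suc (suc m))) ⟩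
    (one ⊕ x) ⊛ T₁ ⊕ mono (tri (suc m)) ⊛ mono (suc m) ⊛ lhs (suc (suc m))
      ≈⟨ ⊕-congˡ ((one ⊕ x) ⊛ T₁) (⊛-congʳ (lhs (suc (suc m))) (mono-+ (tri (suc m)) (suc m))) ⟩
    (one ⊕ x) ⊛ T₁ ⊕ T₂
      ∎

signedRhs-recurrence : ∀ m →
  signedRhs (suc (suc m)) ≋ mono m ⊛ signedRhs m ⊖ (one ⊕ mono m) ⊛ signedRhs (suc m)
signedRhs-recurrence m = begin
  signedRhs (suc (suc m))                 ≈⟨ scale-as-const (signPred m) (rhsBracket (suc (suc m))) ⟩
  s ⊛ rhsBracket (suc (suc m))            ≈⟨ ⊛-congˡ s (rhsBracket-recurrence m) ⟩
  s ⊛ ((one ⊕ x) ⊛ W₁ ⊕ x ⊛ W₀)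
    ≈⟨ solve 4 (λ s x W₀ W₁ → s :* ((con (+ 1) :+ x) :* W₁ :+ x :* W₀)
                             := x :* (s :* W₀) :- (con (+ 1) :+ x) :* (:- s :* W₁)) ≋-refl s x W₀ W₁ ⟩
  x ⊛ (s ⊛ W₀) ⊖ (one ⊕ x) ⊛ (neg s ⊛ W₁)
    ≈⟨ ⊖-cong (⊛-congˡ x (scale-as-const (signPred m) W₀)) (⊛-congˡ (one ⊕ x) sign-flip) ⟨
  x ⊛ signedRhs m ⊖ (one ⊕ x) ⊛ signedRhs (suc m) ∎
  where
  open ≋-Reasoning
  s = const (signPred m)
  x = mono m
  W₀ = rhsBracket m
  W₁ = rhsBracket (suc m)
  sign-flip : signedRhs (suc m) ≋ neg s ⊛ W₁
  sign-flip = ≋-trans (scale-as-const (signPred (suc m)) W₁)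
    (⊛-congʳ W₁ (≋-trans (≋-reflexive (cong const (signPred-suc m))) (const-neg (signPred m))))

scaledLhs≋signedRhs-0 : scaledLhs 0 ≋ signedRhs 0
scaledLhs≋signedRhs-0 = begin
  mono 0 ⊛ lhs 0                    ≈⟨ ≋-trans (⊛-congʳ (lhs 0) mono-zero) (⊛-identityˡ (lhs 0)) ⟩
  lhs 0                             ≈⟨ lhs-zero ⟩
  negQQ2 ⊕ negQ2Q2
    ≈⟨ solve 2 (λ Q₁ Q₂ → Q₁ :+ Q₂ := con -[1+ 0 ] :* ((con (+ 0) :- con (+ 1)) :* Q₂ :- con (+ 1) :* Q₁))
         ≋-refl negQQ2 negQ2Q2 ⟩
  const -[1+ 0 ] ⊛ ((const (+ 0) ⊖ one) ⊛ negQ2Q2 ⊖ one ⊛ negQQ2)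
    ≈⟨ ⊛-congˡ (const -[1+ 0 ]) (⊖-congʳ (one ⊛ negQQ2) (⊛-congʳ negQ2Q2 (⊖-congʳ one zeroPS≋const0))) ⟨
  const -[1+ 0 ] ⊛ rhsBracket 0     ≈⟨ scale-as-const -[1+ 0 ] (rhsBracket 0) ⟨
  signedRhs 0                       ∎
  where open ≋-Reasoning

scaledLhs≋signedRhs-1 : scaledLhs 1 ≋ signedRhs 1
scaledLhs≋signedRhs-1 = begin
  mono 0 ⊛ lhs 1                    ≈⟨ ≋-trans (⊛-congʳ (lhs 1) mono-zero) (⊛-identityˡ (lhs 1)) ⟩
  lhs 1                             ≈⟨ lhs-one ⟩
  negQ2Q2                           ≈⟨ solve 2 (λ Q₁ Q₂ → Q₂ := (con (+ 1) :- con (+ 0)) :* Q₂ :- con (+ 0) :* Q₁)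
                                             ≋-refl negQQ2 negQ2Q2 ⟩
  (one ⊖ const (+ 0)) ⊛ negQ2Q2 ⊖ const (+ 0) ⊛ negQQ2
    ≈⟨ ⊖-cong (⊛-congʳ negQ2Q2 (⊖-cong a₁≋1 b₁≋0)) (⊛-congʳ negQQ2 b₁≋0) ⟨
  rhsBracket 1                      ≈⟨ ≋-trans (scale-as-const (+ 1) (rhsBracket 1)) (⊛-identityˡ (rhsBracket 1)) ⟨
  signedRhs 1                       ∎
  where
  open ≋-Reasoning
  a₁≋1 : aSeries 1 ≋ one
  a₁≋1 = ≋-trans (aSeries≋abSeries 1) (≋-trans (⊕-identityˡ (abTerm 0 1 0)) (abTerm-at-zero 0 0))
  b₁≋0 : bSeries 1 ≋ const (+ 0)
  b₁≋0 = ≋-trans (bSeries≋abSeries 0) zeroPS≋const0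

corollary2p15 : (m : ℕ) →
    mono ((m * (m ∸ 1)) / 2) ⊛ lhs m
    ≋ scale (signPred m) ((aSeries m ⊖ bSeries m) ⊛ negQ2Q2 ⊖ bSeries m ⊛ negQQ2)
corollary2p15 m = ≋-trans (⊛-congʳ (lhs m) (mono-cong (tri-≡tri m)))
  (recurrence-unique mono (λ k → one ⊕ mono k) {scaledLhs} {signedRhs}
     scaledLhs-recurrence signedRhs-recurrence scaledLhs≋signedRhs-0 scaledLhs≋signedRhs-1 m)
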